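{- Let $G$ be a finite abelian group and let $S \subseteq G\setminus\{0\}$ be a symmetric subset (i.e. $S=-S$). Let $H_0$ be an arbitrary finite graph, and let $H$ be an even subdivision of $H_0$. Then \[ t(H,\mathrm{Cay}(G,S)) \;\geq\; t(K_2,\mathrm{Cay}(G,S))^{e(H)}. \]
   Context: For graphs $H$ and $F$, a homomorphism from $H$ to $F$ is a map $\phi:V(H)\to V(F)$ such that $\phi(u)\phi(v)\in E(F)$ whenever $uv\in E(H)$; $\hom(H,F)$ denotes the number of homomorphisms and $t(H,F)=\hom(H,F)/v(F)^{v(H)}$ is the homomorphism density, where $v(\cdot)$ and $e(\cdot)$ denote the numbers of vertices and edges. For a finite abelian group $G$ (written additively) and a symmetric subset $S\subseteq G\setminus\{0\}$, the Cayley graph $\mathrm{Cay}(G,S)$ has vertex set $G$, with $x,y$ adjacent iff $y-x\in S$. An even subdivision of a graph $H_0$ is a graph obtained from $H_0$ by replacing each edge by a path of even (positive) length, where different edges may receive different lengths. $K_2$ is the graph consisting of a single edge. -}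

module Defs where

open import Data.Bool using (Bool; true; false; _∧_; _∨_; not; if_then_else_)
open import Data.Nat using (ℕ; zero; suc; _+_; _*_; _^_; _≡ᵇ_; _<ᵇ_; NonZero)
open import Data.Nat.Properties using (m^n≢0)
open import Data.Fin using (Fin; toℕ; fromℕ<)
import Data.Fin as Fin
open import Data.Fin.Subset using (Subset)
open import Data.List using (List; []; _∷_; [_]; _++_; map; concatMap; sum; length; allFin; filter; cartesianProduct)
open import Data.Bool.ListAction using (all; any)
open import Data.Vec using (Vec; []; _∷_; lookup)
open import Data.Product using (_×_; _,_; proj₁; proj₂)
open import Data.Integer using (+_)
open import Data.Rational using (ℚ; _/_; 1ℚ) renaming (_*_ to _*ℚ_)
open import Relation.Binary.PropositionalEquality using (_≡_)
open import Function using (_∘_)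

record Graph : Set where
  field
    V      : ℕ
    Adj    : Fin V → Fin V → Bool
    sym    : ∀ i j → Adj i j ≡ Adj j i
    irrefl : ∀ i → Adj i i ≡ false
open Graph public

pairs : (n : ℕ) → List (Fin n × Fin n)
pairs n = cartesianProduct (allFin n) (allFin n)

countTrue : List Bool → ℕ
countTrue [] = 0
countTrue (b ∷ bs) = (if b then 1 else 0) + countTrue bs

edgeCount : (n : ℕ) → (Fin n → Fin n → Bool) → ℕ
edgeCount n A = countTrue (map (λ p → (toℕ (proj₁ p) <ᵇ toℕ (proj₂ p)) ∧ A (proj₁ p) (proj₂ p)) (pairs n))

allMaps : (n m : ℕ) → List (Vec (Fin m) n)
allMaps zero m = [ [] ]
allMaps (suc n) m = concatMap (λ v → map (_∷ v) (allFin m)) (allMaps n m)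

isHom : {n m : ℕ} → (Fin n → Fin n → Bool) → (Fin m → Fin m → Bool) → Vec (Fin m) n → Bool
isHom {n} AH AF φ = all (λ p → not (AH (proj₁ p) (proj₂ p)) ∨ AF (lookup φ (proj₁ p)) (lookup φ (proj₂ p))) (pairs n)

homCount : (n : ℕ) → (Fin n → Fin n → Bool) → (m : ℕ) → (Fin m → Fin m → Bool) → ℕ
homCount n AH m AF = countTrue (map (isHom AH AF) (allMaps n m))

homDensity : (n : ℕ) → (Fin n → Fin n → Bool) → (m : ℕ) .{{_ : NonZero m}} → (Fin m → Fin m → Bool) → ℚ
homDensity n AH m AF = (+ homCount n AH m AF) / (m ^ n)
  where instance _ = m^n≢0 m n

_^ℚ_ : ℚ → ℕ → ℚ
q ^ℚ zero = 1ℚ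
q ^ℚ suc k = q *ℚ (q ^ℚ k)

K₂Adj : Fin 2 → Fin 2 → Bool
K₂Adj Fin.zero (Fin.suc Fin.zero) = true
K₂Adj (Fin.suc Fin.zero) Fin.zero = true
K₂Adj _ _ = false

cayleyAdj : {n : ℕ} → (_+_ : Fin n → Fin n → Fin n) → (-_ : Fin n → Fin n) → Subset n → Fin n → Fin n → Bool
cayleyAdj _+_ -_ S x y = lookup S (y + (- x))

-- An even
-- subdivision is determined by assigning to each edge e a length
-- 2 * (k e + 1) ≥ 2; the edge is replaced by a path with 2 * k e + 1 new
-- internal vertices.  New vertices are numbered V(H₀), V(H₀)+1, ... in order.

edgeList : (G : Graph) → List (Fin (V G) × Fin (V G))
edgeList G = filter (λ p → Data.Bool._≟_ ((toℕ (proj₁ p) <ᵇ toℕ (proj₂ p)) ∧ Adj G (proj₁ p) (proj₂ p)) true) (pairs (V G))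
  where import Data.Bool

internal : ℕ → ℕ
internal k = suc (2 * k)

chain : (prev o c b : ℕ) → List (ℕ × ℕ)
chain prev o zero b = [ (prev , b) ]
chain prev o (suc c) b = (prev , o) ∷ chain o (suc o) c b

newVertices : {A : Set} (es : List A) → (Fin (length es) → ℕ) → ℕ
newVertices [] ks = 0
newVertices (_ ∷ es) ks = internal (ks Fin.zero) + newVertices es (ks ∘ Fin.suc)

subdivEdges : {n : ℕ} (o : ℕ) (es : List (Fin n × Fin n)) → (Fin (length es) → ℕ) → List (ℕ × ℕ)
subdivEdges o [] ks = []
subdivEdges o ((a , b) ∷ es) ks =
  chain (toℕ a) o (internal (ks Fin.zero)) (toℕ b)
    ++ subdivEdges (o + internal (ks Fin.zero)) es (ks ∘ Fin.suc)

subdivV : (H₀ : Graph) → (Fin (length (edgeList H₀)) → ℕ) → ℕ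
subdivV H₀ ks = V H₀ + newVertices (edgeList H₀) ks

subdivAdj : (H₀ : Graph) → (ks : Fin (length (edgeList H₀)) → ℕ)
          → Fin (subdivV H₀ ks) → Fin (subdivV H₀ ks) → Bool
subdivAdj H₀ ks u v =
  any (λ p → ((proj₁ p ≡ᵇ toℕ u) ∧ (proj₂ p ≡ᵇ toℕ v)) ∨ ((proj₁ p ≡ᵇ toℕ v) ∧ (proj₂ p ≡ᵇ toℕ u)))
      (subdivEdges (V H₀) (edgeList H₀) ks)

{-# OPTIONS --safe #-}
module Submission where

-- Let A be the adjacency matrix of Cay(G, S), d = |S| its degree and n = |G|, and let the edge ab of H₀ become
-- a path of length 2(k + 1) in H. Summing out the inner vertices, hom(H, Cay) = Σ_φ Π_ab A^(2k+2)(φa, φb) over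
-- φ : V(H₀) → G. Split every path at its midpoint, A^(2k+2)(x, y) = Σ_m A^(k+1)(x, m) A^(k+1)(m, y), and use
-- that A^(k+1)(x, y) depends only on y − x: with s(u) = Σ_φ Π_ab A^(k+1)(φb − φa, u_ab) for u ∈ G^E(H₀),
-- translation invariance gives Σ_u s(u) = n^v(H₀) Π_ab d^(k+1) and Σ_u s(u)² = n^v(H₀) hom(H, Cay).
-- Cauchy–Schwarz then yields hom(H, Cay) ≥ n^(v(H₀) − e(H₀)) d^e(H), that is
-- t(H, Cay) ≥ (d/n)^e(H) = t(K₂, Cay)^e(H).

open import Data.Nat using (ℕ; zero; suc; _+_; _*_; _^_; NonZero)
open import Data.Nat.Properties
open import Data.Bool using (Bool; true; false; if_then_else_)
open import Data.Fin using (Fin; toℕ)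
import Data.Fin as Fin
open import Data.List using (List; []; _∷_; length; map; allFin)
open import Data.Vec using (Vec; []; _∷_; lookup)
open import Data.Product using (_×_; _,_; proj₁; proj₂)
open import Data.Sum using ([_,_]′)
open import Function using (_∘_; id)
import Data.Fin.Subset as Subset
open import Algebra.Structures using (IsAbelianGroup)
open import Relation.Binary.PropositionalEquality
  using (_≡_; refl; sym; trans; cong; cong₂; subst; subst₂; module ≡-Reasoning)

module ListSum where
  open import Data.Nat using (_≤_)
  open import Data.List using (_++_; concatMap; tabulate)
  import Algebra.Properties.CommutativeMonoid.Sum as MonoidSum
  module ℕSum = MonoidSum +-0-commutativeMonoid
  open import Algebra.Properties.CommutativeSemigroup +-commutativeSemigroup using () renaming (interchange to +-interchange)
  open import Data.Nat.Tactic.RingSolver using (solve-∀)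

  sumOver : {A : Set} → List A → (A → ℕ) → ℕ
  sumOver [] f = 0
  sumOver (x ∷ xs) f = f x + sumOver xs f

  infix 6.5 sumOver
  syntax sumOver xs (λ x → e) = ∑[ x ← xs ] e

  module _ {A : Set} where
    ∑-cong : (xs : List A) {f g : A → ℕ} → (∀ x → f x ≡ g x) → ∑[ x ← xs ] f x ≡ ∑[ x ← xs ] g x
    ∑-cong [] eq = refl
    ∑-cong (x ∷ xs) eq = cong₂ _+_ (eq x) (∑-cong xs eq)

    ∑-mono-≤ : (xs : List A) {f g : A → ℕ} → (∀ x → f x ≤ g x) → ∑[ x ← xs ] f x ≤ ∑[ x ← xs ] g x
    ∑-mono-≤ [] le = ≤-refl
    ∑-mono-≤ (x ∷ xs) le = +-mono-≤ (le x) (∑-mono-≤ xs le)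

    ∑-++ : (xs ys : List A) (f : A → ℕ) → ∑[ x ← xs ++ ys ] f x ≡ ∑[ x ← xs ] f x + ∑[ y ← ys ] f y
    ∑-++ [] ys f = refl
    ∑-++ (x ∷ xs) ys f = trans (cong (f x +_) (∑-++ xs ys f)) (sym (+-assoc (f x) _ _))

    ∑-distrib-+ : (xs : List A) (f g : A → ℕ) → ∑[ x ← xs ] (f x + g x) ≡ ∑[ x ← xs ] f x + ∑[ x ← xs ] g x
    ∑-distrib-+ [] f g = refl
    ∑-distrib-+ (x ∷ xs) f g = trans (cong (f x + g x +_) (∑-distrib-+ xs f g)) (+-interchange (f x) _ _ _)

    *-distribˡ-∑ : (c : ℕ) (xs : List A) (f : A → ℕ) → c * (∑[ x ← xs ] f x) ≡ ∑[ x ← xs ] c * f x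
    *-distribˡ-∑ c [] f = *-zeroʳ c
    *-distribˡ-∑ c (x ∷ xs) f = trans (*-distribˡ-+ c (f x) _) (cong (c * f x +_) (*-distribˡ-∑ c xs f))

    *-distribʳ-∑ : (c : ℕ) (xs : List A) (f : A → ℕ) → (∑[ x ← xs ] f x) * c ≡ ∑[ x ← xs ] f x * c
    *-distribʳ-∑ c xs f = trans (*-comm _ c) (trans (*-distribˡ-∑ c xs f) (∑-cong xs (λ x → *-comm c (f x))))

    ∑-const : (xs : List A) (c : ℕ) → ∑[ x ← xs ] c ≡ length xs * c
    ∑-const [] c = refl
    ∑-const (x ∷ xs) c = cong (c +_) (∑-const xs c)

    ∑-tabulate : ∀ {k} (g : Fin k → A) (f : A → ℕ) → ∑[ x ← tabulate g ] f x ≡ ℕSum.sum (f ∘ g)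
    ∑-tabulate {zero} g f = refl
    ∑-tabulate {suc k} g f = cong (f (g Fin.zero) +_) (∑-tabulate (g ∘ Fin.suc) f)

  module _ {A B : Set} where
    ∑-map : (g : A → B) (xs : List A) (f : B → ℕ) → ∑[ y ← map g xs ] f y ≡ ∑[ x ← xs ] f (g x)
    ∑-map g [] f = refl
    ∑-map g (x ∷ xs) f = cong (f (g x) +_) (∑-map g xs f)

    ∑-concatMap : (g : A → List B) (xs : List A) (f : B → ℕ) →
                  ∑[ y ← concatMap g xs ] f y ≡ ∑[ x ← xs ] ∑[ y ← g x ] f y
    ∑-concatMap g [] f = refl
    ∑-concatMap g (x ∷ xs) f = trans (∑-++ (g x) _ f) (cong (_ +_) (∑-concatMap g xs f))

    ∑-comm : (xs : List A) (ys : List B) (f : A → B → ℕ) →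
             ∑[ x ← xs ] ∑[ y ← ys ] f x y ≡ ∑[ y ← ys ] ∑[ x ← xs ] f x y
    ∑-comm [] ys f = trans (sym (*-zeroʳ (length ys))) (sym (∑-const ys 0))
    ∑-comm (x ∷ xs) ys f = trans (cong (_ +_) (∑-comm xs ys f)) (sym (∑-distrib-+ ys (f x) _))

    ∑-*-∑ : (xs : List A) (ys : List B) (f : A → ℕ) (g : B → ℕ) →
            (∑[ x ← xs ] f x) * (∑[ y ← ys ] g y) ≡ ∑[ x ← xs ] ∑[ y ← ys ] f x * g y
    ∑-*-∑ xs ys f g = trans (*-distribʳ-∑ _ xs f) (∑-cong xs (λ x → *-distribˡ-∑ (f x) ys g))

  m*n+m*n≤m*m+n*n : ∀ m n → m * n + m * n ≤ m * m + n * n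
  m*n+m*n≤m*m+n*n m n = [ ordered , flipped ]′ (≤-total m n)
    where
    ordered : ∀ {a b} → a ≤ b → a * b + a * b ≤ a * a + b * b
    ordered {a} a≤b with t , refl ← m≤n⇒∃[o]m+o≡n a≤b =
      subst (a * (a + t) + a * (a + t) ≤_) (expand a t) (m≤m+n _ (t * t))
      where expand : ∀ a t → a * (a + t) + a * (a + t) + t * t ≡ a * a + (a + t) * (a + t)
            expand = solve-∀
    flipped : n ≤ m → m * n + m * n ≤ m * m + n * n
    flipped n≤m = subst₂ _≤_ (cong₂ _+_ (*-comm n m) (*-comm n m)) (+-comm (n * n) (m * m)) (ordered n≤m)

  cauchy-schwarz : {A : Set} (xs : List A) (f : A → ℕ) →
                   (∑[ x ← xs ] f x) * (∑[ x ← xs ] f x) ≤ length xs * (∑[ x ← xs ] f x * f x)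
  cauchy-schwarz xs f = *-cancelˡ-≤ 2 (begin
    2 * (Σf * Σf)                                         ≡⟨ double (Σf * Σf) ⟩
    Σf * Σf + Σf * Σf                                     ≡⟨ cong₂ _+_ (∑-*-∑ xs xs f f) (∑-*-∑ xs xs f f) ⟩
    ∑[ x ← xs ] ∑[ y ← xs ] f x * f y
      + ∑[ x ← xs ] ∑[ y ← xs ] f x * f y                 ≡⟨ sym (∑-distrib-+ xs _ _) ⟩
    ∑[ x ← xs ] (∑[ y ← xs ] f x * f y + ∑[ y ← xs ] f x * f y)
                                                          ≡⟨ ∑-cong xs (λ x → sym (∑-distrib-+ xs _ _)) ⟩
    ∑[ x ← xs ] ∑[ y ← xs ] (f x * f y + f x * f y)       ≤⟨ ∑-mono-≤ xs (λ x → ∑-mono-≤ xs (λ y → m*n+m*n≤m*m+n*n (f x) (f y))) ⟩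
    ∑[ x ← xs ] ∑[ y ← xs ] (f x * f x + f y * f y)       ≡⟨ ∑-cong xs (λ x → ∑-distrib-+ xs _ _) ⟩
    ∑[ x ← xs ] (∑[ y ← xs ] f x * f x + Σf²)             ≡⟨ ∑-distrib-+ xs _ _ ⟩
    ∑[ x ← xs ] ∑[ y ← xs ] f x * f x + ∑[ x ← xs ] Σf²   ≡⟨ cong₂ _+_ (∑-cong xs (λ x → ∑-const xs (f x * f x))) (∑-const xs Σf²) ⟩
    ∑[ x ← xs ] length xs * (f x * f x) + length xs * Σf² ≡⟨ cong (_+ length xs * Σf²) (sym (*-distribˡ-∑ (length xs) xs _)) ⟩
    length xs * Σf² + length xs * Σf²                     ≡⟨ sym (double (length xs * Σf²)) ⟩
    2 * (length xs * Σf²)                                 ∎)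
    where
    open ≤-Reasoning
    Σf = ∑[ x ← xs ] f x
    Σf² = ∑[ x ← xs ] f x * f x
    double : ∀ m → 2 * m ≡ m + m
    double m = cong (m +_) (+-identityʳ m)

module Ratio where
  open import Data.Nat using (_≤_; pred)
  open import Data.Nat.Tactic.RingSolver using (solve-∀)
  open import Data.Integer using (+_)
  import Data.Integer as ℤ
  import Data.Integer.Properties as ℤ
  open import Data.Rational using (_/_; toℚᵘ) renaming (_≤_ to _≤ℚ_)
  import Data.Rational.Properties as ℚ
  open import Data.Rational.Unnormalised
    using (ℚᵘ; mkℚᵘ; *≡*; *≤*) renaming (_≃_ to _≃ᵘ_; _≤_ to _≤ᵘ_; _*_ to _*ᵘ_)
  import Data.Rational.Unnormalised.Properties as ℚᵘ
  open import Defs using (_^ℚ_)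

  -- x / m without normalisation (junk value for m = 0)
  frac : ℕ → ℕ → ℚᵘ
  frac x m = mkℚᵘ (+ x) (pred m)

  toℚᵘ-/ : ∀ x m .{{_ : NonZero m}} → toℚᵘ (+ x / m) ≃ᵘ frac x m
  toℚᵘ-/ x (suc m) = ℚ.toℚᵘ-fromℚᵘ (frac x (suc m))

  frac-cong : ∀ x y m k .{{_ : NonZero m}} .{{_ : NonZero k}} → x * k ≡ y * m → frac x m ≃ᵘ frac y k
  frac-cong x y (suc m) (suc k) eq = *≡* (trans (sym (ℤ.pos-* x (suc k))) (trans (cong +_ eq) (ℤ.pos-* y (suc m))))

  /-cong-cross : ∀ x y m k .{{_ : NonZero m}} .{{_ : NonZero k}} → x * k ≡ y * m → + x / m ≡ + y / k
  /-cong-cross x y m k eq =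
    ℚ.toℚᵘ-injective (ℚᵘ.≃-trans (toℚᵘ-/ x m) (ℚᵘ.≃-trans (frac-cong x y m k eq) (ℚᵘ.≃-sym (toℚᵘ-/ y k))))

  frac-mono-≤ : ∀ x y m k .{{_ : NonZero m}} .{{_ : NonZero k}} → x * k ≤ y * m → frac x m ≤ᵘ frac y k
  frac-mono-≤ x y (suc m) (suc k) le =
    *≤* (subst₂ ℤ._≤_ (ℤ.pos-* x (suc k)) (ℤ.pos-* y (suc m)) (ℤ.+≤+ le))

  frac-* : ∀ x y m k .{{_ : NonZero m}} .{{_ : NonZero k}} → frac x m *ᵘ frac y k ≃ᵘ frac (x * y) (m * k)
  frac-* x y (suc m) (suc k) = *≡* (cong (ℤ._* + suc (k + m * suc k)) (sym (ℤ.pos-* x y)))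

  toℚᵘ-/-^ℚ : ∀ x m .{{_ : NonZero m}} E → toℚᵘ ((+ x / m) ^ℚ E) ≃ᵘ frac (x ^ E) (m ^ E)
  toℚᵘ-/-^ℚ x m zero = ℚᵘ.≃-refl
  toℚᵘ-/-^ℚ x m (suc E) = ℚᵘ.≃-trans (ℚ.toℚᵘ-homo-* (+ x / m) _)
    (ℚᵘ.≃-trans (ℚᵘ.*-cong (toℚᵘ-/ x m) (toℚᵘ-/-^ℚ x m E)) (frac-* x (x ^ E) m (m ^ E)))
    where instance _ = m^n≢0 m E

  /-^ℚ-≤-/ : ∀ x m h k E .{{_ : NonZero m}} .{{_ : NonZero k}} →
             x ^ E * k ≤ h * m ^ E → (+ x / m) ^ℚ E ≤ℚ + h / k
  /-^ℚ-≤-/ x m h k E le = ℚ.toℚᵘ-cancel-≤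
    (ℚᵘ.≤-respˡ-≃ (ℚᵘ.≃-sym (toℚᵘ-/-^ℚ x m E))
      (ℚᵘ.≤-respʳ-≃ (ℚᵘ.≃-sym (toℚᵘ-/ h k)) (frac-mono-≤ (x ^ E) h (m ^ E) k le)))
    where instance _ = m^n≢0 m E

  -- (d / n) ^ E ≤ (d / n) ^ e ≤ h / M
  ^-ratio-antimono : ∀ {d n h M e E} → d ≤ n → d ^ e * M ≤ h * n ^ e → e ≤ E → d ^ E * M ≤ h * n ^ E
  ^-ratio-antimono {d} {n} {h} {M} {e} d≤n le e≤E with r , refl ← m≤n⇒∃[o]m+o≡n e≤E = begin
    d ^ (e + r) * M      ≡⟨ cong (_* M) (^-distribˡ-+-* d e r) ⟩
    d ^ e * d ^ r * M    ≡⟨ regroup (d ^ e) (d ^ r) M ⟩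
    d ^ r * (d ^ e * M)  ≤⟨ *-mono-≤ (^-monoˡ-≤ r d≤n) le ⟩
    n ^ r * (h * n ^ e)  ≡⟨ regroup′ (n ^ r) h (n ^ e) ⟩
    h * (n ^ e * n ^ r)  ≡⟨ cong (h *_) (sym (^-distribˡ-+-* n e r)) ⟩
    h * n ^ (e + r)      ∎
    where
    open ≤-Reasoning
    regroup : ∀ a b c → a * b * c ≡ b * (a * c)
    regroup = solve-∀
    regroup′ : ∀ a b c → a * (b * c) ≡ b * (c * a)
    regroup′ = solve-∀

module Counting where
  open import Data.Nat using (_≤_; z≤n; s≤s)
  open import Data.Bool using (T; T?; _∧_; _∨_; not)
  open import Data.Bool.ListAction using (all; any)
  open import Data.List using (_++_; filterᵇ)
  import Data.List.Properties as List
  open import Data.List.Relation.Unary.All using (All; []; _∷_)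
  open import Data.List.Relation.Unary.Any using (Any; here; there)
  import Data.List.Relation.Unary.All as All
  open import Data.List.Membership.Propositional using (_∈_)
  import Data.List.Membership.Propositional.Properties as ∈
  open import Data.List.Relation.Unary.Unique.Propositional using (Unique)
  open import Data.List.Relation.Unary.AllPairs using (_∷_)
  open import Data.Product using (∃-syntax)
  open import Data.Sum using (inj₁; inj₂)
  open import Data.Empty using (⊥-elim)
  open import Data.Bool.Properties using (T-∧; T-∨)
  open import Function.Bundles using (_⇔_; mk⇔; Equivalence)
  open Equivalence using (to; from)
  open import Defs using (countTrue)
  open ListSum

  ⟦_⟧ : Bool → ℕ
  ⟦ b ⟧ = if b then 1 else 0

  ⟦∧⟧ : ∀ a b → ⟦ a ∧ b ⟧ ≡ ⟦ a ⟧ * ⟦ b ⟧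
  ⟦∧⟧ true b = sym (+-identityʳ ⟦ b ⟧)
  ⟦∧⟧ false b = refl

  ⟦⟧≤1 : ∀ b → ⟦ b ⟧ ≤ 1
  ⟦⟧≤1 true = ≤-refl
  ⟦⟧≤1 false = z≤n

  T-ext : ∀ {a b} → (T a → T b) → (T b → T a) → a ≡ b
  T-ext {true} {true} _ _ = refl
  T-ext {true} {false} a⇒b _ = ⊥-elim (a⇒b _)
  T-ext {false} {true} _ b⇒a = ⊥-elim (b⇒a _)
  T-ext {false} {false} _ _ = refl

  T-implies : ∀ a b → T (not a ∨ b) ⇔ (T a → T b)
  T-implies true b = mk⇔ (λ t _ → t) (λ f → f _)
  T-implies false b = mk⇔ (λ _ ()) (λ _ → _)

  module _ {A : Set} (p : A → Bool) where
    countTrue-map : ∀ xs → countTrue (map p xs) ≡ ∑[ x ← xs ] ⟦ p x ⟧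
    countTrue-map [] = refl
    countTrue-map (x ∷ xs) = cong (⟦ p x ⟧ +_) (countTrue-map xs)

    length-filterᵇ : ∀ xs → length (filterᵇ p xs) ≡ countTrue (map p xs)
    length-filterᵇ [] = refl
    length-filterᵇ (x ∷ xs) with p x
    ... | true = cong suc (length-filterᵇ xs)
    ... | false = length-filterᵇ xs

    T-all : ∀ xs → T (all p xs) ⇔ All (T ∘ p) xs
    T-all [] = mk⇔ (λ _ → []) (λ _ → _)
    T-all (x ∷ xs) = mk⇔
      (λ t → let (px , pxs) = to T-∧ t in px ∷ to (T-all xs) pxs)
      (λ { (px ∷ pxs) → from T-∧ (px , from (T-all xs) pxs) })

    T-any : ∀ xs → T (any p xs) ⇔ Any (T ∘ p) xs
    T-any [] = mk⇔ (λ ()) (λ ())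
    T-any (x ∷ xs) = mk⇔
      (λ t → [ here , there ∘ to (T-any xs) ]′ (to T-∨ t))
      (λ { (here px) → from T-∨ (inj₁ px) ; (there pxs) → from T-∨ (inj₂ (from (T-any xs) pxs)) })

  Unique⇒length-≤ : {A : Set} {xs ys : List A} → Unique xs → (∀ {x} → x ∈ xs → x ∈ ys) → length xs ≤ length ys
  Unique⇒length-≤ {xs = []} _ _ = z≤n
  Unique⇒length-≤ {xs = x ∷ xs} (x∉xs ∷ xs!) xs⊆ys with ys₁ , ys₂ , refl ← ∈.∈-∃++ (xs⊆ys (here refl)) = begin
    suc (length xs)                  ≤⟨ s≤s (Unique⇒length-≤ xs! xs⊆ys₁++ys₂) ⟩
    suc (length (ys₁ ++ ys₂))        ≡⟨ cong suc (List.length-++ ys₁) ⟩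
    suc (length ys₁ + length ys₂)    ≡⟨ sym (+-suc (length ys₁) _) ⟩
    length ys₁ + length (x ∷ ys₂)    ≡⟨ sym (List.length-++ ys₁) ⟩
    length (ys₁ ++ x ∷ ys₂)          ∎
    where
    open ≤-Reasoning
    xs⊆ys₁++ys₂ : ∀ {z} → z ∈ xs → z ∈ ys₁ ++ ys₂
    xs⊆ys₁++ys₂ z∈xs with ∈.∈-++⁻ ys₁ (xs⊆ys (there z∈xs))
    ... | inj₁ z∈ys₁ = ∈.∈-++⁺ˡ z∈ys₁
    ... | inj₂ (here refl) = ⊥-elim (All.lookup x∉xs z∈xs refl)
    ... | inj₂ (there z∈ys₂) = ∈.∈-++⁺ʳ ys₁ z∈ys₂

  Unique⇒length-≤-countTrue : {A B : Set} (g : B → A) (p : B → Bool) {xs : List A} {ys : List B} → Unique xs →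
    (∀ {x} → x ∈ xs → ∃[ y ] (y ∈ ys × T (p y) × g y ≡ x)) → length xs ≤ countTrue (map p ys)
  Unique⇒length-≤-countTrue g p {xs} {ys} xs! covered = begin
    length xs                       ≤⟨ Unique⇒length-≤ xs! xs⊆ ⟩
    length (map g (filterᵇ p ys))   ≡⟨ List.length-map g (filterᵇ p ys) ⟩
    length (filterᵇ p ys)           ≡⟨ length-filterᵇ p ys ⟩
    countTrue (map p ys)            ∎
    where
    open ≤-Reasoning
    xs⊆ : ∀ {x} → x ∈ xs → x ∈ map g (filterᵇ p ys)
    xs⊆ x∈xs with y , y∈ys , py , refl ← covered x∈xs = ∈.∈-map⁺ g (∈.∈-filter⁺ (T? ∘ p) y∈ys py)

module Subdivision where
  open import Data.Nat using (_≤_; _<_; _⊓_; _⊔_; _≡ᵇ_; _<ᵇ_; s≤s)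
  open import Data.List using (_++_)
  open import Data.Bool using (T; _∧_; _∨_)
  open import Data.Bool.Properties using (T-∧; T-∨; T-≡)
  open import Data.Bool.ListAction using (any)
  open import Data.Fin using (fromℕ<)
  import Data.Fin.Properties as Fin
  import Data.List.Properties as List
  open import Data.List.Relation.Unary.All using (All; []; _∷_)
  import Data.List.Relation.Unary.All as All
  import Data.List.Relation.Unary.All.Properties as All
  import Data.List.Relation.Unary.Any as Any
  open import Data.List.Relation.Unary.Any.Properties using (Any-⊎⁺; Any-⊎⁻)
  open import Data.List.Membership.Propositional using (_∈_)
  import Data.List.Membership.Propositional.Properties as ∈
  open import Data.List.Relation.Unary.Unique.Propositional using (Unique)
  open import Data.List.Relation.Unary.AllPairs using ([]; _∷_)
  import Data.List.Relation.Unary.Unique.Propositional.Properties as Unique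
  open import Data.Sum using (_⊎_; inj₁; inj₂)
  import Data.Sum as Sum
  open import Data.Empty using (⊥)
  import Data.Product as Product
  open import Data.Product using (∃-syntax)
  open import Relation.Binary.PropositionalEquality using (_≢_)
  open import Function.Bundles using (_⇔_; mk⇔; Equivalence)
  open Equivalence using (to; from)
  open import Defs using (V; edgeList; pairs; chain; internal; newVertices; subdivEdges; subdivV; subdivAdj; edgeCount)
  open Counting

  -- subdivAdj H₀ ks is adjOf (subdivEdges (V H₀) (edgeList H₀) ks) by definition
  adjOf : {N : ℕ} → List (ℕ × ℕ) → Fin N → Fin N → Bool
  adjOf L u v = any (λ p → ((proj₁ p ≡ᵇ toℕ u) ∧ (proj₂ p ≡ᵇ toℕ v)) ∨ ((proj₁ p ≡ᵇ toℕ v) ∧ (proj₂ p ≡ᵇ toℕ u))) L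

  T-≡ᵇ-pair : ∀ p q a b → T ((p ≡ᵇ a) ∧ (q ≡ᵇ b)) ⇔ ((a , b) ≡ (p , q))
  T-≡ᵇ-pair p q a b = mk⇔
    (λ t → let (p≡a , q≡b) = to T-∧ t in sym (cong₂ _,_ (≡ᵇ⇒≡ p a p≡a) (≡ᵇ⇒≡ q b q≡b)))
    (λ { refl → from T-∧ (≡⇒≡ᵇ p p refl , ≡⇒≡ᵇ q q refl) })

  T-adjOf : ∀ {N} L (u v : Fin N) → T (adjOf L u v) ⇔ ((toℕ u , toℕ v) ∈ L ⊎ (toℕ v , toℕ u) ∈ L)
  T-adjOf L u v = mk⇔
    (λ t → Any-⊎⁻ (Any.map (λ {e} → Sum.map (to (pair e u v)) (to (pair e v u)) ∘ to T-∨) (to (T-any _ L) t)))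
    (λ uv∈ → from (T-any _ L) (Any.map (λ {e} → from T-∨ ∘ Sum.map (from (pair e u v)) (from (pair e v u))) (Any-⊎⁺ uv∈)))
    where pair : ∀ {N} e (u v : Fin N) → T ((proj₁ e ≡ᵇ toℕ u) ∧ (proj₂ e ≡ᵇ toℕ v)) ⇔ ((toℕ u , toℕ v) ≡ e)
          pair e u v = T-≡ᵇ-pair (proj₁ e) (proj₂ e) (toℕ u) (toℕ v)

  internal≡ : ∀ k → internal k ≡ k + suc k
  internal≡ k = trans (cong (λ j → suc (k + j)) (+-identityʳ k)) (sym (+-suc k k))

  Bounded : ℕ → List (ℕ × ℕ) → Set
  Bounded N = All (λ e → proj₁ e < N × proj₂ e < N)

  Bounded-mono : ∀ {N M} L → N ≤ M → Bounded N L → Bounded M L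
  Bounded-mono L N≤M = All.map (λ (p<N , q<N) → ≤-trans p<N N≤M , ≤-trans q<N N≤M)

  chain-bounded : ∀ c p o q → p < o → q < o → Bounded (o + c) (chain p o c q)
  chain-bounded zero p o q p<o q<o = (o+0 p<o , o+0 q<o) ∷ []
    where o+0 : ∀ {x} → x < o → x < o + 0
          o+0 = subst (_ <_) (sym (+-identityʳ o))
  chain-bounded (suc c) p o q p<o q<o =
    (<-≤-trans p<o (m≤m+n o (suc c)) , subst (o <_) (sym (+-suc o c)) (s≤s (m≤m+n o c)))
    ∷ subst (λ B → Bounded B (chain o (suc o) c q)) (sym (+-suc o c)) (chain-bounded c o (suc o) q ≤-refl (m≤n⇒m≤1+n q<o))

  module _ {V₀ : ℕ} where
    subdivEdges-bounded : ∀ (es : List (Fin V₀ × Fin V₀)) ks o → V₀ ≤ o →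
                          Bounded (o + newVertices es ks) (subdivEdges o es ks)
    subdivEdges-bounded [] ks o V₀≤o = []
    subdivEdges-bounded ((a , b) ∷ es) ks o V₀≤o = All.++⁺
      (Bounded-mono ch (≤-trans (m≤m+n (o + c) m) (≤-reflexive (+-assoc o c m)))
        (chain-bounded c (toℕ a) o (toℕ b) (<-≤-trans (Fin.toℕ<n a) V₀≤o) (<-≤-trans (Fin.toℕ<n b) V₀≤o)))
      (subst (λ B → Bounded B (subdivEdges (o + c) es (ks ∘ Fin.suc))) (+-assoc o c m)
        (subdivEdges-bounded es (ks ∘ Fin.suc) (o + c) (≤-trans V₀≤o (m≤m+n o c))))
      where
      c = internal (ks Fin.zero)
      m = newVertices es (ks ∘ Fin.suc)
      ch = chain (toℕ a) o c (toℕ b)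

  length-chain : ∀ c p o q → length (chain p o c q) ≡ suc c
  length-chain zero p o q = refl
  length-chain (suc c) p o q = cong suc (length-chain c o (suc o) q)

  length-subdivEdges : ∀ {V₀} (es : List (Fin V₀ × Fin V₀)) ks o →
                       length (subdivEdges o es ks) ≡ newVertices es ks + length es
  length-subdivEdges [] ks o = refl
  length-subdivEdges ((a , b) ∷ es) ks o = begin
    length (chain (toℕ a) o c (toℕ b) ++ subdivEdges (o + c) es ks′)
      ≡⟨ List.length-++ (chain (toℕ a) o c (toℕ b)) ⟩
    length (chain (toℕ a) o c (toℕ b)) + length (subdivEdges (o + c) es ks′)
      ≡⟨ cong₂ _+_ (length-chain c (toℕ a) o (toℕ b)) (length-subdivEdges es ks′ (o + c)) ⟩
    suc c + (m + length es)   ≡⟨ sym (+-suc c _) ⟩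
    c + suc (m + length es)   ≡⟨ cong (c +_) (sym (+-suc m _)) ⟩
    c + (m + suc (length es)) ≡⟨ sym (+-assoc c m _) ⟩
    c + m + suc (length es)   ∎
    where
    open ≡-Reasoning
    ks′ = ks ∘ Fin.suc
    c = internal (ks Fin.zero)
    m = newVertices es ks′

  minMax : ℕ × ℕ → ℕ × ℕ
  minMax (p , q) = p ⊓ q , p ⊔ q

  minMax-≤ : ∀ {p q} → p ≤ q → minMax (p , q) ≡ (p , q)
  minMax-≤ p≤q = cong₂ _,_ (m≤n⇒m⊓n≡m p≤q) (m≤n⇒m⊔n≡n p≤q)

  minMax-≥ : ∀ {p q} → q ≤ p → minMax (p , q) ≡ (q , p)
  minMax-≥ q≤p = cong₂ _,_ (m≥n⇒m⊓n≡n q≤p) (m≥n⇒m⊔n≡m q≤p)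

  Fresh : ℕ → ℕ × ℕ → Set
  Fresh o (i , j) = i < j × o ≤ j

  -- Sorted, the chain edges are (p , o), (o , o + 1), …, (o + c − 1 , o + c), (q , o + c):
  -- only the last two share their larger end, and they differ in the smaller one.
  chain-minMax : ∀ c p o q → p < o → q < o → p ≢ q →
    Unique (map minMax (chain p o (suc c) q)) × All (λ e → Fresh o e × proj₂ e ≤ o + c) (map minMax (chain p o (suc c) q))
  chain-minMax zero p o q p<o q<o p≢q
    rewrite minMax-≤ (<⇒≤ p<o) | minMax-≥ (<⇒≤ q<o) =
    ((λ eq → p≢q (cong proj₁ eq)) ∷ []) ∷ [] ∷ [] ,
    ((p<o , ≤-refl) , m≤m+n o 0) ∷ ((q<o , ≤-refl) , m≤m+n o 0) ∷ []
  chain-minMax (suc c) p o q p<o q<o p≢q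
    with rest! , rest-fresh ← chain-minMax c o (suc o) q ≤-refl (m≤n⇒m≤1+n q<o) (λ { refl → <-irrefl refl q<o })
    rewrite minMax-≤ (<⇒≤ p<o) =
    All.map (λ ((_ , o<j) , _) eq → <-irrefl (cong proj₂ eq) o<j) rest-fresh ∷ rest! ,
    ((p<o , ≤-refl) , m≤m+n o (suc c))
      ∷ All.map (λ ((i<j , o<j) , j≤) → (i<j , <⇒≤ o<j) , ≤-trans j≤ (≤-reflexive (sym (+-suc o c)))) rest-fresh

  subdivEdges-minMax : ∀ {V₀} (es : List (Fin V₀ × Fin V₀)) ks o → V₀ ≤ o →
    All (λ e → toℕ (proj₁ e) < toℕ (proj₂ e)) es →
    Unique (map minMax (subdivEdges o es ks)) × All (Fresh o) (map minMax (subdivEdges o es ks))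
  subdivEdges-minMax [] ks o V₀≤o [] = [] , []
  subdivEdges-minMax ((a , b) ∷ es) ks o V₀≤o (a<b ∷ es<)
    with ch! , ch-fresh ← chain-minMax (2 * ks Fin.zero) (toℕ a) o (toℕ b)
                            (<-≤-trans (Fin.toℕ<n a) V₀≤o) (<-≤-trans (Fin.toℕ<n b) V₀≤o) (<⇒≢ a<b)
       | rest! , rest-fresh ← subdivEdges-minMax es (ks ∘ Fin.suc) (o + internal (ks Fin.zero)) (≤-trans V₀≤o (m≤m+n o _)) es<
    rewrite List.map-++ minMax (chain (toℕ a) o (internal (ks Fin.zero)) (toℕ b)) (subdivEdges (o + internal (ks Fin.zero)) es (ks ∘ Fin.suc)) =
    Unique.++⁺ ch! rest! (λ (e∈ch , e∈rest) → disjoint (All.lookup ch-fresh e∈ch) (All.lookup rest-fresh e∈rest)) ,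
    All.++⁺ (All.map proj₁ ch-fresh) (All.map (λ (i<j , o+c≤j) → i<j , ≤-trans (m≤m+n o c) o+c≤j) rest-fresh)
    where
    c = internal (ks Fin.zero)
    disjoint : ∀ {e} → Fresh o e × proj₂ e ≤ o + 2 * ks Fin.zero → Fresh (o + c) e → ⊥
    disjoint (_ , j≤) (_ , o+c≤j) = <-irrefl refl (≤-trans (≤-reflexive (sym (+-suc o _))) (≤-trans o+c≤j j≤))

  minMax∈ : ∀ {e L} → e ∈ L → minMax e ∈ L ⊎ Product.swap (minMax e) ∈ L
  minMax∈ {p , q} e∈L with ≤-total p q
  ... | inj₁ p≤q rewrite minMax-≤ p≤q = inj₁ e∈L
  ... | inj₂ q≤p rewrite m≥n⇒m⊓n≡n q≤p | m≥n⇒m⊔n≡m q≤p = inj₂ e∈L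

  edgeCount-≥ : ∀ N L → Bounded N L → Unique (map minMax L) → All (λ e → proj₁ e < proj₂ e) (map minMax L) →
                length L ≤ edgeCount N (adjOf L)
  edgeCount-≥ N L bounded minMax! sorted = begin
    length L                 ≡⟨ sym (List.length-map minMax L) ⟩
    length (map minMax L)    ≤⟨ Unique⇒length-≤-countTrue toℕ² isEdge minMax! covered ⟩
    edgeCount N (adjOf L)    ∎
    where
    open ≤-Reasoning
    toℕ² : Fin N × Fin N → ℕ × ℕ
    toℕ² (u , v) = toℕ u , toℕ v
    isEdge : Fin N × Fin N → Bool
    isEdge (u , v) = (toℕ u <ᵇ toℕ v) ∧ adjOf L u v
    covered : ∀ {x} → x ∈ map minMax L → ∃[ y ] (y ∈ pairs N × T (isEdge y) × toℕ² y ≡ x)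
    covered x∈ with (p , q) , e∈L , refl ← ∈.∈-map⁻ minMax x∈ =
      (u , v) , ∈.∈-cartesianProduct⁺ (∈.∈-allFin u) (∈.∈-allFin v) , from T-∧ (u<ᵇv , uv-adjacent) , cong₂ _,_ tu tv
      where
      p<N×q<N = All.lookup bounded e∈L
      i<N : p ⊓ q < N
      i<N = ≤-<-trans (m⊓n≤m p q) (proj₁ p<N×q<N)
      j<N : p ⊔ q < N
      j<N = ⊔-lub (proj₁ p<N×q<N) (proj₂ p<N×q<N)
      u = fromℕ< i<N
      v = fromℕ< j<N
      tu = Fin.toℕ-fromℕ< i<N
      tv = Fin.toℕ-fromℕ< j<N
      u<ᵇv : T (toℕ u <ᵇ toℕ v)
      u<ᵇv = subst₂ (λ i j → T (i <ᵇ j)) (sym tu) (sym tv) (<⇒<ᵇ (All.lookup sorted x∈))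
      uv-adjacent : T (adjOf L u v)
      uv-adjacent = from (T-adjOf L u v) (subst₂ (λ i j → (i , j) ∈ L ⊎ (j , i) ∈ L) (sym tu) (sym tv) (minMax∈ e∈L))

  edgeList-sorted : ∀ H₀ → All (λ e → toℕ (proj₁ e) < toℕ (proj₂ e)) (edgeList H₀)
  edgeList-sorted H₀ = All.map (λ isEdge → <ᵇ⇒< _ _ (proj₁ (to T-∧ (from T-≡ isEdge))))
                               (All.all-filter (λ _ → _ Data.Bool.≟ true) (pairs (V H₀)))
    where import Data.Bool

  -- only the lower bound is needed, since t(K₂, Cay) ≤ 1
  edgeCount-subdivision : ∀ H₀ ks →
    newVertices (edgeList H₀) ks + length (edgeList H₀) ≤ edgeCount (subdivV H₀ ks) (subdivAdj H₀ ks)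
  edgeCount-subdivision H₀ ks = begin
    newVertices es ks + length es     ≡⟨ sym (length-subdivEdges es ks (V H₀)) ⟩
    length L                          ≤⟨ edgeCount-≥ (subdivV H₀ ks) L (subdivEdges-bounded es ks (V H₀) ≤-refl) L! (All.map proj₁ L-fresh) ⟩
    edgeCount (subdivV H₀ ks) (subdivAdj H₀ ks) ∎
    where
    open ≤-Reasoning
    es = edgeList H₀
    L = subdivEdges (V H₀) es ks
    L!×L-fresh = subdivEdges-minMax es ks (V H₀) ≤-refl (edgeList-sorted H₀)
    L! = proj₁ L!×L-fresh
    L-fresh = proj₂ L!×L-fresh

module EdgeProduct {X K : Set} where
  ∏ᴱ : (es : List (X × X)) → (Fin (length es) → K) → (X → X → K → ℕ) → ℕ
  ∏ᴱ [] ks w = 1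
  ∏ᴱ ((a , b) ∷ es) ks w = w a b (ks Fin.zero) * ∏ᴱ es (ks ∘ Fin.suc) w

  ∏ᴱ-cong : ∀ es ks {w w′} → (∀ a b k → w a b k ≡ w′ a b k) → ∏ᴱ es ks w ≡ ∏ᴱ es ks w′
  ∏ᴱ-cong [] ks eq = refl
  ∏ᴱ-cong ((a , b) ∷ es) ks eq = cong₂ _*_ (eq a b _) (∏ᴱ-cong es _ eq)

  ∏ᴱ-* : ∀ es ks w w′ → ∏ᴱ es ks w * ∏ᴱ es ks w′ ≡ ∏ᴱ es ks (λ a b k → w a b k * w′ a b k)
  ∏ᴱ-* [] ks w w′ = refl
  ∏ᴱ-* ((a , b) ∷ es) ks w w′ =
    trans (*-interchange (w a b _) _ (w′ a b _) _) (cong (w a b _ * w′ a b _ *_) (∏ᴱ-* es _ w w′))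
    where open import Algebra.Properties.CommutativeSemigroup *-commutativeSemigroup
            using () renaming (interchange to *-interchange)

module Assignments (n : ℕ) where
  open import Data.Vec using (_++_)
  import Data.List.Properties as List
  open import Defs using (allMaps)
  open ListSum
  open EdgeProduct

  ∑-allFin-const : ∀ c → ∑[ x ← allFin n ] c ≡ n * c
  ∑-allFin-const c = trans (∑-const (allFin n) c) (cong (_* c) (List.length-tabulate {n = n} id))

  ∑-allMaps-suc : ∀ k (f : Vec (Fin n) (suc k) → ℕ) →
                  ∑[ v ← allMaps (suc k) n ] f v ≡ ∑[ v ← allMaps k n ] ∑[ x ← allFin n ] f (x ∷ v)
  ∑-allMaps-suc k f = trans (∑-concatMap (λ v → map (_∷ v) (allFin n)) (allMaps k n) f)
                            (∑-cong (allMaps k n) (λ v → ∑-map (_∷ v) (allFin n) f))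

  ∑-allMaps-++ : ∀ a b (f : Vec (Fin n) (a + b) → ℕ) →
                 ∑[ v ← allMaps (a + b) n ] f v ≡ ∑[ u ← allMaps a n ] ∑[ w ← allMaps b n ] f (u ++ w)
  ∑-allMaps-++ zero b f = sym (+-identityʳ _)
  ∑-allMaps-++ (suc a) b f = begin
    ∑[ v ← allMaps (suc (a + b)) n ] f v                                      ≡⟨ ∑-allMaps-suc (a + b) f ⟩
    ∑[ v ← allMaps (a + b) n ] ∑[ x ← allFin n ] f (x ∷ v)                    ≡⟨ ∑-allMaps-++ a b _ ⟩
    ∑[ u ← allMaps a n ] ∑[ w ← allMaps b n ] ∑[ x ← allFin n ] f (x ∷ u ++ w)
      ≡⟨ ∑-cong (allMaps a n) (λ u → ∑-comm (allMaps b n) (allFin n) _) ⟩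
    ∑[ u ← allMaps a n ] ∑[ x ← allFin n ] ∑[ w ← allMaps b n ] f (x ∷ u ++ w) ≡⟨ sym (∑-allMaps-suc a _) ⟩
    ∑[ u ← allMaps (suc a) n ] ∑[ w ← allMaps b n ] f (u ++ w)                ∎
    where open ≡-Reasoning

  ∑-allMaps-const : ∀ k c → ∑[ v ← allMaps k n ] c ≡ n ^ k * c
  ∑-allMaps-const zero c = refl
  ∑-allMaps-const (suc k) c = begin
    ∑[ v ← allMaps (suc k) n ] c                  ≡⟨ ∑-allMaps-suc k _ ⟩
    ∑[ v ← allMaps k n ] ∑[ x ← allFin n ] c      ≡⟨ ∑-cong (allMaps k n) (λ _ → ∑-allFin-const c) ⟩
    ∑[ v ← allMaps k n ] n * c                    ≡⟨ ∑-allMaps-const k (n * c) ⟩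
    n ^ k * (n * c)                               ≡⟨ sym (*-assoc (n ^ k) n c) ⟩
    n ^ k * n * c                                 ≡⟨ cong (_* c) (*-comm (n ^ k) n) ⟩
    n ^ suc k * c                                 ∎
    where open ≡-Reasoning

  length-allMaps : ∀ k → length (allMaps k n) ≡ n ^ k
  length-allMaps k = *-cancelʳ-≡ _ _ 1 (trans (sym (∑-const (allMaps k n) 1)) (∑-allMaps-const k 1))

  ∑-∏ᴱ : ∀ {X K : Set} (es : List (X × X)) (ks : Fin (length es) → K) (w : X → X → K × Fin n → ℕ) →
         ∑[ u ← allMaps (length es) n ] ∏ᴱ es (λ i → ks i , lookup u i) w
           ≡ ∏ᴱ es ks (λ a b k → ∑[ m ← allFin n ] w a b (k , m))
  ∑-∏ᴱ [] ks w = refl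
  ∑-∏ᴱ ((a , b) ∷ es) ks w = begin
    ∑[ u ← allMaps (suc l) n ] ∏ᴱ ((a , b) ∷ es) (λ i → ks i , lookup u i) w
      ≡⟨ ∑-allMaps-suc l _ ⟩
    ∑[ u ← allMaps l n ] ∑[ m ← allFin n ] w a b (k₀ , m) * ∏ᴱ es (λ i → ks′ i , lookup u i) w
      ≡⟨ ∑-comm (allMaps l n) (allFin n) _ ⟩
    ∑[ m ← allFin n ] ∑[ u ← allMaps l n ] w a b (k₀ , m) * ∏ᴱ es (λ i → ks′ i , lookup u i) w
      ≡⟨ sym (∑-*-∑ (allFin n) (allMaps l n) _ _) ⟩
    (∑[ m ← allFin n ] w a b (k₀ , m)) * (∑[ u ← allMaps l n ] ∏ᴱ es (λ i → ks′ i , lookup u i) w)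
      ≡⟨ cong ((∑[ m ← allFin n ] w a b (k₀ , m)) *_) (∑-∏ᴱ es ks′ w) ⟩
    (∑[ m ← allFin n ] w a b (k₀ , m)) * ∏ᴱ es ks′ (λ a b k → ∑[ m ← allFin n ] w a b (k , m))
      ∎
    where
    open ≡-Reasoning
    l = length es
    k₀ = ks Fin.zero
    ks′ = ks ∘ Fin.suc

module Lookupℕ {A : Set} (a₀ : A) where
  open import Data.Nat using (_<_; s≤s)
  open import Data.Vec using (_++_; _∷ʳ_)
  open import Data.Fin using (fromℕ<)
  import Data.Fin.Properties as Fin

  -- indices past the end give a₀
  lookupℕ : ∀ {k} → Vec A k → ℕ → A
  lookupℕ [] _ = a₀
  lookupℕ (x ∷ xs) zero = x
  lookupℕ (x ∷ xs) (suc i) = lookupℕ xs i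

  lookupℕ-toℕ : ∀ {k} (xs : Vec A k) (i : Fin k) → lookupℕ xs (toℕ i) ≡ lookup xs i
  lookupℕ-toℕ (x ∷ xs) Fin.zero = refl
  lookupℕ-toℕ (x ∷ xs) (Fin.suc i) = lookupℕ-toℕ xs i

  lookupℕ-fromℕ< : ∀ {k i} (xs : Vec A k) .(i<k : i < k) → lookup xs (fromℕ< i<k) ≡ lookupℕ xs i
  lookupℕ-fromℕ< xs i<k = trans (sym (lookupℕ-toℕ xs (fromℕ< i<k))) (cong (lookupℕ xs) (Fin.toℕ-fromℕ< i<k))

  lookupℕ-++ˡ : ∀ {k m} (xs : Vec A k) (ys : Vec A m) i → i < k → lookupℕ (xs ++ ys) i ≡ lookupℕ xs i
  lookupℕ-++ˡ (x ∷ xs) ys zero _ = refl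
  lookupℕ-++ˡ (x ∷ xs) ys (suc i) (s≤s i<k) = lookupℕ-++ˡ xs ys i i<k

  lookupℕ-++-assoc : ∀ {k l m} (xs : Vec A k) (ys : Vec A l) (zs : Vec A m) i →
                     lookupℕ (xs ++ (ys ++ zs)) i ≡ lookupℕ ((xs ++ ys) ++ zs) i
  lookupℕ-++-assoc [] ys zs i = refl
  lookupℕ-++-assoc (x ∷ xs) ys zs zero = refl
  lookupℕ-++-assoc (x ∷ xs) ys zs (suc i) = lookupℕ-++-assoc xs ys zs i

  lookupℕ-++-∷ : ∀ {k m} (xs : Vec A k) y (ys : Vec A m) i → lookupℕ (xs ++ y ∷ ys) i ≡ lookupℕ ((xs ∷ʳ y) ++ ys) i
  lookupℕ-++-∷ [] y ys zero = refl
  lookupℕ-++-∷ [] y ys (suc i) = refl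
  lookupℕ-++-∷ (x ∷ xs) y ys zero = refl
  lookupℕ-++-∷ (x ∷ xs) y ys (suc i) = lookupℕ-++-∷ xs y ys i

  lookupℕ-++-length : ∀ {k m} (xs : Vec A k) y (ys : Vec A m) → lookupℕ (xs ++ y ∷ ys) k ≡ y
  lookupℕ-++-length [] y ys = refl
  lookupℕ-++-length (x ∷ xs) y ys = lookupℕ-++-length xs y ys

  lookupℕ-∷ʳ-length : ∀ {k} (xs : Vec A k) y → lookupℕ (xs ∷ʳ y) k ≡ y
  lookupℕ-∷ʳ-length [] y = refl
  lookupℕ-∷ʳ-length (x ∷ xs) y = lookupℕ-∷ʳ-length xs y

  lookupℕ-∷ʳ-< : ∀ {k} (xs : Vec A k) y i → i < k → lookupℕ (xs ∷ʳ y) i ≡ lookupℕ xs i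
  lookupℕ-∷ʳ-< (x ∷ xs) y zero _ = refl
  lookupℕ-∷ʳ-< (x ∷ xs) y (suc i) (s≤s i<k) = lookupℕ-∷ʳ-< xs y i i<k

module Walks {n : ℕ} .{{_ : NonZero n}} (adj : Fin n → Fin n → Bool) (adj-sym : ∀ x y → adj x y ≡ adj y x) where
  open import Data.Nat using (_≤_; _<_; >-nonZero⁻¹)
  open import Data.Bool using (T; _∧_; _∨_; not)
  open import Data.Bool.ListAction using (all)
  open import Data.Fin using (fromℕ<)
  import Data.Fin.Properties as Fin
  open import Data.List using (_++_)
  open import Data.Vec using (_∷ʳ_) renaming (_++_ to _++ᵛ_)
  open import Data.List.Relation.Unary.All using (All; []; _∷_)
  import Data.List.Relation.Unary.All as All
  open import Data.List.Membership.Propositional using (_∈_)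
  import Data.List.Membership.Propositional.Properties as ∈
  open import Data.Sum using (inj₁; inj₂)
  open import Function.Bundles using (Equivalence)
  open Equivalence using (to; from)
  open import Defs using (V; edgeList; pairs; allMaps; isHom; homCount; K₂Adj; chain; internal; newVertices; subdivEdges; subdivV; subdivAdj)
  open ListSum
  open Counting
  open Subdivision
  open EdgeProduct
  open Assignments n

  vertex₀ : Fin n
  vertex₀ = fromℕ< (>-nonZero⁻¹ n)

  open Lookupℕ vertex₀

  A : Fin n → Fin n → ℕ
  A x y = ⟦ adj x y ⟧

  A-sym : ∀ x y → A x y ≡ A y x
  A-sym x y = cong ⟦_⟧ (adj-sym x y)

  -- walks c a b counts the walks a → b with c inner vertices: it is the (a , b) entry of A ^ (c + 1)
  walks : ℕ → Fin n → Fin n → ℕ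
  walks zero a b = A a b
  walks (suc c) a b = ∑[ m ← allFin n ] A a m * walks c m b

  walks-split : ∀ c₁ c₂ a b → walks (c₁ + suc c₂) a b ≡ ∑[ m ← allFin n ] walks c₁ a m * walks c₂ m b
  walks-split zero c₂ a b = refl
  walks-split (suc c₁) c₂ a b = begin
    ∑[ x ← allFin n ] A a x * walks (c₁ + suc c₂) x b
      ≡⟨ ∑-cong (allFin n) (λ x → cong (A a x *_) (walks-split c₁ c₂ x b)) ⟩
    ∑[ x ← allFin n ] A a x * (∑[ m ← allFin n ] walks c₁ x m * walks c₂ m b)
      ≡⟨ ∑-cong (allFin n) (λ x → *-distribˡ-∑ (A a x) (allFin n) _) ⟩
    ∑[ x ← allFin n ] ∑[ m ← allFin n ] A a x * (walks c₁ x m * walks c₂ m b)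
      ≡⟨ ∑-comm (allFin n) (allFin n) _ ⟩
    ∑[ m ← allFin n ] ∑[ x ← allFin n ] A a x * (walks c₁ x m * walks c₂ m b)
      ≡⟨ ∑-cong (allFin n) (λ m → ∑-cong (allFin n) (λ x → sym (*-assoc (A a x) _ _))) ⟩
    ∑[ m ← allFin n ] ∑[ x ← allFin n ] A a x * walks c₁ x m * walks c₂ m b
      ≡⟨ ∑-cong (allFin n) (λ m → sym (*-distribʳ-∑ (walks c₂ m b) (allFin n) _)) ⟩
    ∑[ m ← allFin n ] walks (suc c₁) a m * walks c₂ m b ∎
    where open ≡-Reasoning

  walks-sym : ∀ c a b → walks c a b ≡ walks c b a
  walks-sym zero a b = A-sym a b
  walks-sym (suc c) a b = begin
    ∑[ m ← allFin n ] A a m * walks c m b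
      ≡⟨ ∑-cong (allFin n) (λ m → trans (cong₂ _*_ (A-sym a m) (walks-sym c m b)) (*-comm (A m a) _)) ⟩
    ∑[ m ← allFin n ] walks c b m * walks zero m a ≡⟨ sym (walks-split c zero b a) ⟩
    walks (c + 1) b a                               ≡⟨ cong (λ c′ → walks c′ b a) (+-comm c 1) ⟩
    walks (suc c) b a                               ∎
    where open ≡-Reasoning

  homWeight : (ℕ → Fin n) → List (ℕ × ℕ) → ℕ
  homWeight ρ [] = 1
  homWeight ρ ((p , q) ∷ L) = A (ρ p) (ρ q) * homWeight ρ L

  homWeight-cong : ∀ {ρ ρ′} L → (∀ i → ρ i ≡ ρ′ i) → homWeight ρ L ≡ homWeight ρ′ L
  homWeight-cong [] eq = refl
  homWeight-cong ((p , q) ∷ L) eq = cong₂ _*_ (cong₂ A (eq p) (eq q)) (homWeight-cong L eq)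

  homWeight-agree : ∀ {ρ ρ′} N L → Bounded N L → (∀ i → i < N → ρ i ≡ ρ′ i) → homWeight ρ L ≡ homWeight ρ′ L
  homWeight-agree N [] [] eq = refl
  homWeight-agree N ((p , q) ∷ L) ((p<N , q<N) ∷ bounded) eq =
    cong₂ _*_ (cong₂ A (eq p p<N) (eq q q<N)) (homWeight-agree N L bounded eq)

  homWeight-++ : ∀ ρ L L′ → homWeight ρ (L ++ L′) ≡ homWeight ρ L * homWeight ρ L′
  homWeight-++ ρ [] L′ = sym (+-identityʳ _)
  homWeight-++ ρ ((p , q) ∷ L) L′ =
    trans (cong (A (ρ p) (ρ q) *_) (homWeight-++ ρ L L′)) (sym (*-assoc (A (ρ p) (ρ q)) _ _))

  homWeight-all : ∀ ρ L → homWeight ρ L ≡ ⟦ all (λ e → adj (ρ (proj₁ e)) (ρ (proj₂ e))) L ⟧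
  homWeight-all ρ [] = refl
  homWeight-all ρ ((p , q) ∷ L) = trans (cong (A (ρ p) (ρ q) *_) (homWeight-all ρ L)) (sym (⟦∧⟧ (adj (ρ p) (ρ q)) _))

  isHom-adjOf : ∀ N L → Bounded N L → (ψ : Vec (Fin n) N) →
                isHom (adjOf L) adj ψ ≡ all (λ e → adj (lookupℕ ψ (proj₁ e)) (lookupℕ ψ (proj₂ e))) L
  isHom-adjOf N L bounded ψ = T-ext
    (λ hom → from (T-all _ L) (All.tabulate (edge-preserved (All.lookup (to (T-all _ (pairs N)) hom)))))
    (λ preserved → from (T-all _ (pairs N)) (All.tabulate (λ {(u , v)} _ →
       from (T-implies (adjOf L u v) _) (adjacency-preserved (All.lookup (to (T-all _ L) preserved)) u v))))
    where
    HomAt : Fin N × Fin N → Set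
    HomAt (u , v) = T (not (adjOf L u v) ∨ adj (lookup ψ u) (lookup ψ v))
    PreservedAt : ℕ × ℕ → Set
    PreservedAt (p , q) = T (adj (lookupℕ ψ p) (lookupℕ ψ q))

    edge-preserved : (∀ {uv} → uv ∈ pairs N → HomAt uv) → ∀ {e} → e ∈ L → PreservedAt e
    edge-preserved hom {p , q} e∈L = subst₂ (λ x y → T (adj x y)) (lookupℕ-fromℕ< ψ p<N) (lookupℕ-fromℕ< ψ q<N)
      (to (T-implies (adjOf L u v) _) (hom (∈.∈-cartesianProduct⁺ (∈.∈-allFin u) (∈.∈-allFin v)))
        (from (T-adjOf L u v) (inj₁ uv∈L)))
      where
      p<N = proj₁ (All.lookup bounded e∈L)
      q<N = proj₂ (All.lookup bounded e∈L)
      u = fromℕ< p<N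
      v = fromℕ< q<N
      uv∈L : (toℕ u , toℕ v) ∈ L
      uv∈L = subst₂ (λ i j → (i , j) ∈ L) (sym (Fin.toℕ-fromℕ< p<N)) (sym (Fin.toℕ-fromℕ< q<N)) e∈L

    adjacency-preserved : (∀ {e} → e ∈ L → PreservedAt e) → ∀ u v → T (adjOf L u v) → T (adj (lookup ψ u) (lookup ψ v))
    adjacency-preserved preserved u v uv-adjacent with to (T-adjOf L u v) uv-adjacent
    ... | inj₁ uv∈L = subst₂ (λ x y → T (adj x y)) (lookupℕ-toℕ ψ u) (lookupℕ-toℕ ψ v) (preserved uv∈L)
    ... | inj₂ vu∈L = subst T (adj-sym _ _)
                        (subst₂ (λ x y → T (adj x y)) (lookupℕ-toℕ ψ v) (lookupℕ-toℕ ψ u) (preserved vu∈L))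

  homCount-adjOf : ∀ N L → Bounded N L → homCount N (adjOf L) n adj ≡ ∑[ ψ ← allMaps N n ] homWeight (lookupℕ ψ) L
  homCount-adjOf N L bounded = trans (countTrue-map _ (allMaps N n))
    (∑-cong (allMaps N n) (λ ψ → trans (cong ⟦_⟧ (isHom-adjOf N L bounded ψ)) (sym (homWeight-all (lookupℕ ψ) L))))

  chain-walks : ∀ c o (pre : Vec (Fin n) o) p q → p < o → q < o →
    ∑[ x ← allMaps c n ] homWeight (lookupℕ (pre ++ᵛ x)) (chain p o c q) ≡ walks c (lookupℕ pre p) (lookupℕ pre q)
  chain-walks zero o pre p q p<o q<o =
    trans (+-identityʳ _) (trans (*-identityʳ _) (cong₂ A (lookupℕ-++ˡ pre [] p p<o) (lookupℕ-++ˡ pre [] q q<o)))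
  chain-walks (suc c) o pre p q p<o q<o = begin
    ∑[ x ← allMaps (suc c) n ] homWeight (lookupℕ (pre ++ᵛ x)) (chain p o (suc c) q)
      ≡⟨ ∑-allMaps-suc c _ ⟩
    ∑[ x ← allMaps c n ] ∑[ y ← allFin n ] homWeight (lookupℕ (pre ++ᵛ y ∷ x)) (chain p o (suc c) q)
      ≡⟨ ∑-comm (allMaps c n) (allFin n) _ ⟩
    ∑[ y ← allFin n ] ∑[ x ← allMaps c n ] homWeight (lookupℕ (pre ++ᵛ y ∷ x)) (chain p o (suc c) q)
      ≡⟨ ∑-cong (allFin n) (λ y → ∑-cong (allMaps c n) (first-edge y)) ⟩
    ∑[ y ← allFin n ] ∑[ x ← allMaps c n ] A a y * homWeight (lookupℕ ((pre ∷ʳ y) ++ᵛ x)) rest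
      ≡⟨ ∑-cong (allFin n) (λ y → sym (*-distribˡ-∑ (A a y) (allMaps c n) _)) ⟩
    ∑[ y ← allFin n ] A a y * (∑[ x ← allMaps c n ] homWeight (lookupℕ ((pre ∷ʳ y) ++ᵛ x)) rest)
      ≡⟨ ∑-cong (allFin n) (λ y → cong (A a y *_) (rest-walks y)) ⟩
    walks (suc c) a b ∎
    where
    open ≡-Reasoning
    a = lookupℕ pre p
    b = lookupℕ pre q
    rest = chain o (suc o) c q
    first-edge : ∀ y x → homWeight (lookupℕ (pre ++ᵛ y ∷ x)) (chain p o (suc c) q)
                         ≡ A a y * homWeight (lookupℕ ((pre ∷ʳ y) ++ᵛ x)) rest
    first-edge y x = cong₂ _*_ (cong₂ A (lookupℕ-++ˡ pre (y ∷ x) p p<o) (lookupℕ-++-length pre y x))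
                               (homWeight-cong rest (lookupℕ-++-∷ pre y x))
    rest-walks : ∀ y → ∑[ x ← allMaps c n ] homWeight (lookupℕ ((pre ∷ʳ y) ++ᵛ x)) rest ≡ walks c y b
    rest-walks y = trans (chain-walks c (suc o) (pre ∷ʳ y) o q ≤-refl (m≤n⇒m≤1+n q<o))
                         (cong₂ (walks c) (lookupℕ-∷ʳ-length pre y) (lookupℕ-∷ʳ-< pre y q q<o))

  subdivEdges-walks : ∀ {V₀} (es : List (Fin V₀ × Fin V₀)) ks o (pre : Vec (Fin n) o) → V₀ ≤ o →
    ∑[ r ← allMaps (newVertices es ks) n ] homWeight (lookupℕ (pre ++ᵛ r)) (subdivEdges o es ks)
      ≡ ∏ᴱ es ks (λ a b k → walks (internal k) (lookupℕ pre (toℕ a)) (lookupℕ pre (toℕ b)))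
  subdivEdges-walks [] ks o pre V₀≤o = refl
  subdivEdges-walks ((a , b) ∷ es) ks o pre V₀≤o = begin
    ∑[ r ← allMaps (c + m) n ] homWeight (lookupℕ (pre ++ᵛ r)) (ch ++ rest)
      ≡⟨ ∑-allMaps-++ c m _ ⟩
    ∑[ x ← allMaps c n ] ∑[ r ← allMaps m n ] homWeight (lookupℕ (pre ++ᵛ (x ++ᵛ r))) (ch ++ rest)
      ≡⟨ ∑-cong (allMaps c n) (λ x → ∑-cong (allMaps m n) (λ r → split x r)) ⟩
    ∑[ x ← allMaps c n ] ∑[ r ← allMaps m n ] homWeight (lookupℕ (pre ++ᵛ x)) ch * homWeight (lookupℕ ((pre ++ᵛ x) ++ᵛ r)) rest
      ≡⟨ ∑-cong (allMaps c n) (λ x → sym (*-distribˡ-∑ (homWeight (lookupℕ (pre ++ᵛ x)) ch) (allMaps m n) _)) ⟩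
    ∑[ x ← allMaps c n ] homWeight (lookupℕ (pre ++ᵛ x)) ch * (∑[ r ← allMaps m n ] homWeight (lookupℕ ((pre ++ᵛ x) ++ᵛ r)) rest)
      ≡⟨ ∑-cong (allMaps c n) (λ x → cong (homWeight (lookupℕ (pre ++ᵛ x)) ch *_) (rest-walks x)) ⟩
    ∑[ x ← allMaps c n ] homWeight (lookupℕ (pre ++ᵛ x)) ch * K
      ≡⟨ sym (*-distribʳ-∑ K (allMaps c n) _) ⟩
    (∑[ x ← allMaps c n ] homWeight (lookupℕ (pre ++ᵛ x)) ch) * K
      ≡⟨ cong (_* K) (chain-walks c o pre (toℕ a) (toℕ b) a<o b<o) ⟩
    walks c (lookupℕ pre (toℕ a)) (lookupℕ pre (toℕ b)) * K ∎
    where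
    open ≡-Reasoning
    ks′ = ks ∘ Fin.suc
    c = internal (ks Fin.zero)
    m = newVertices es ks′
    ch = chain (toℕ a) o c (toℕ b)
    rest = subdivEdges (o + c) es ks′
    K = ∏ᴱ es ks′ (λ a b k → walks (internal k) (lookupℕ pre (toℕ a)) (lookupℕ pre (toℕ b)))
    a<o = <-≤-trans (Fin.toℕ<n a) V₀≤o
    b<o = <-≤-trans (Fin.toℕ<n b) V₀≤o
    split : ∀ x r → homWeight (lookupℕ (pre ++ᵛ (x ++ᵛ r))) (ch ++ rest)
                    ≡ homWeight (lookupℕ (pre ++ᵛ x)) ch * homWeight (lookupℕ ((pre ++ᵛ x) ++ᵛ r)) rest
    split x r = begin
      homWeight (lookupℕ (pre ++ᵛ (x ++ᵛ r))) (ch ++ rest)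
        ≡⟨ homWeight-cong (ch ++ rest) (lookupℕ-++-assoc pre x r) ⟩
      homWeight (lookupℕ ((pre ++ᵛ x) ++ᵛ r)) (ch ++ rest)
        ≡⟨ homWeight-++ _ ch rest ⟩
      homWeight (lookupℕ ((pre ++ᵛ x) ++ᵛ r)) ch * homWeight (lookupℕ ((pre ++ᵛ x) ++ᵛ r)) rest
        ≡⟨ cong (_* homWeight (lookupℕ ((pre ++ᵛ x) ++ᵛ r)) rest) (homWeight-agree (o + c) ch (chain-bounded c (toℕ a) o (toℕ b) a<o b<o) (lookupℕ-++ˡ (pre ++ᵛ x) r)) ⟩
      homWeight (lookupℕ (pre ++ᵛ x)) ch * homWeight (lookupℕ ((pre ++ᵛ x) ++ᵛ r)) rest ∎
    rest-walks : ∀ x → ∑[ r ← allMaps m n ] homWeight (lookupℕ ((pre ++ᵛ x) ++ᵛ r)) rest ≡ K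
    rest-walks x = trans (subdivEdges-walks es ks′ (o + c) (pre ++ᵛ x) (≤-trans V₀≤o (m≤m+n o c)))
      (∏ᴱ-cong es ks′ (λ a′ b′ k → cong₂ (walks (internal k))
        (lookupℕ-++ˡ pre x (toℕ a′) (<-≤-trans (Fin.toℕ<n a′) V₀≤o))
        (lookupℕ-++ˡ pre x (toℕ b′) (<-≤-trans (Fin.toℕ<n b′) V₀≤o))))

  homCount-subdivision : ∀ H₀ ks → homCount (subdivV H₀ ks) (subdivAdj H₀ ks) n adj
    ≡ ∑[ φ ← allMaps (V H₀) n ] ∏ᴱ (edgeList H₀) ks (λ a b k → walks (internal k) (lookup φ a) (lookup φ b))
  homCount-subdivision H₀ ks = begin
    homCount (subdivV H₀ ks) (subdivAdj H₀ ks) n adj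
      ≡⟨ homCount-adjOf (subdivV H₀ ks) L (subdivEdges-bounded es ks (V H₀) ≤-refl) ⟩
    ∑[ ψ ← allMaps (V H₀ + newVertices es ks) n ] homWeight (lookupℕ ψ) L
      ≡⟨ ∑-allMaps-++ (V H₀) (newVertices es ks) _ ⟩
    ∑[ φ ← allMaps (V H₀) n ] ∑[ r ← allMaps (newVertices es ks) n ] homWeight (lookupℕ (φ ++ᵛ r)) L
      ≡⟨ ∑-cong (allMaps (V H₀) n) (λ φ → subdivEdges-walks es ks (V H₀) φ ≤-refl) ⟩
    ∑[ φ ← allMaps (V H₀) n ] ∏ᴱ es ks (λ a b k → walks (internal k) (lookupℕ φ (toℕ a)) (lookupℕ φ (toℕ b)))
      ≡⟨ ∑-cong (allMaps (V H₀) n) (λ φ → ∏ᴱ-cong es ks (λ a b k → cong₂ (walks (internal k)) (lookupℕ-toℕ φ a) (lookupℕ-toℕ φ b))) ⟩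
    ∑[ φ ← allMaps (V H₀) n ] ∏ᴱ es ks (λ a b k → walks (internal k) (lookup φ a) (lookup φ b)) ∎
    where
    open ≡-Reasoning
    es = edgeList H₀
    L = subdivEdges (V H₀) es ks

  homCount-K₂ : homCount 2 K₂Adj n adj ≡ ∑[ y ← allFin n ] ∑[ x ← allFin n ] A y x
  homCount-K₂ = begin
    homCount 2 K₂Adj n adj                                             ≡⟨ countTrue-map _ (allMaps 2 n) ⟩
    ∑[ v ← allMaps 2 n ] ⟦ isHom K₂Adj adj v ⟧                         ≡⟨ ∑-allMaps-suc 1 _ ⟩
    ∑[ v ← allMaps 1 n ] ∑[ x ← allFin n ] ⟦ isHom K₂Adj adj (x ∷ v) ⟧ ≡⟨ ∑-allMaps-suc 0 _ ⟩
    ∑[ y ← allFin n ] ∑[ x ← allFin n ] ⟦ isHom K₂Adj adj (x ∷ y ∷ []) ⟧ + 0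
      ≡⟨ +-identityʳ _ ⟩
    ∑[ y ← allFin n ] ∑[ x ← allFin n ] ⟦ adj x y ∧ (adj y x ∧ true) ⟧
      ≡⟨ ∑-cong (allFin n) (λ y → ∑-cong (allFin n) (λ x → K₂-hom x y)) ⟩
    ∑[ y ← allFin n ] ∑[ x ← allFin n ] A y x ∎
    where
    open ≡-Reasoning
    K₂-hom : ∀ x y → ⟦ adj x y ∧ (adj y x ∧ true) ⟧ ≡ A y x
    K₂-hom x y rewrite adj-sym x y with adj y x
    ... | true = refl
    ... | false = refl

module Cayley {n : ℕ} .{{_ : NonZero n}}
  (_∙_ : Fin n → Fin n → Fin n) (0# : Fin n) (-_ : Fin n → Fin n)
  (isAbelianGroup : IsAbelianGroup _≡_ _∙_ 0# -_)
  (S : Subset.Subset n) (S-sym : ∀ x → x Subset.∈ S → (- x) Subset.∈ S) where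
  open import Data.Nat using (_≤_)
  open import Data.Vec using (zipWith)
  import Data.Vec as Vec
  import Data.Vec.Properties as Vec
  open import Data.Fin.Permutation using (permutation)
  open import Algebra.Bundles using (AbelianGroup)
  open import Data.Integer using (+_)
  open import Data.Rational using (_/_)
  open import Data.Nat.Tactic.RingSolver using (solve-∀)
  open import Defs using (V; edgeList; subdivV; subdivAdj; newVertices; cayleyAdj; allMaps; homCount; homDensity; K₂Adj; internal)
  open ListSum
  open Ratio using (/-cong-cross)
  open Subdivision using (internal≡)
  open Counting
  open EdgeProduct
  open Assignments n

  private
    G : AbelianGroup _ _
    G = record { isAbelianGroup = isAbelianGroup }

  open AbelianGroup G using (identityʳ; inverseʳ)
    renaming (_∙_ to infixl 6 _+ᴳ_; _⁻¹ to infix 8 -ᴳ_; _-_ to infixl 6 _-ᴳ_)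
  open import Algebra.Properties.AbelianGroup G
    using (⁻¹-anti-homo‿-; ⁻¹-∙-comm; ⁻¹-involutive; //-rightDividesˡ; //-rightDividesʳ)
  open import Data.Bool.Properties using (T-≡)
  open import Function.Bundles using (Equivalence)
  open Equivalence using (to; from)
  open import Algebra.Properties.CommutativeSemigroup (AbelianGroup.commutativeSemigroup G) using (interchange)

  adj : Fin n → Fin n → Bool
  adj = cayleyAdj _+ᴳ_ -ᴳ_ S

  lookup-S-neg : ∀ z → lookup S z ≡ lookup S (-ᴳ z)
  lookup-S-neg z = T-ext (from T-≡ ∘ S-closed ∘ to T-≡)
                         (from T-≡ ∘ subst (λ w → lookup S w ≡ true) (⁻¹-involutive z) ∘ S-closed ∘ to T-≡)
    where
    S-closed : ∀ {w} → lookup S w ≡ true → lookup S (-ᴳ w) ≡ true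
    S-closed {w} w∈S = Vec.[]=⇒lookup (S-sym w (Vec.lookup⇒[]= w S w∈S))

  adj-sym : ∀ x y → adj x y ≡ adj y x
  adj-sym x y = trans (lookup-S-neg (y -ᴳ x)) (cong (lookup S) (⁻¹-anti-homo‿- y x))

  open Walks adj adj-sym

  -ᴳ-translate : ∀ x y t → (y +ᴳ t) -ᴳ (x +ᴳ t) ≡ y -ᴳ x
  -ᴳ-translate x y t = begin
    (y +ᴳ t) +ᴳ -ᴳ (x +ᴳ t)       ≡⟨ cong ((y +ᴳ t) +ᴳ_) (sym (⁻¹-∙-comm x t)) ⟩
    (y +ᴳ t) +ᴳ (-ᴳ x +ᴳ -ᴳ t)    ≡⟨ interchange y t (-ᴳ x) (-ᴳ t) ⟩
    (y -ᴳ x) +ᴳ (t +ᴳ -ᴳ t)       ≡⟨ cong ((y -ᴳ x) +ᴳ_) (inverseʳ t) ⟩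
    (y -ᴳ x) +ᴳ 0#                ≡⟨ identityʳ _ ⟩
    y -ᴳ x                        ∎
    where open ≡-Reasoning

  -ᴳ-interchange : ∀ x y z w → (x -ᴳ y) -ᴳ (z -ᴳ w) ≡ (x -ᴳ z) -ᴳ (y -ᴳ w)
  -ᴳ-interchange x y z w = begin
    (x -ᴳ y) +ᴳ -ᴳ (z -ᴳ w)            ≡⟨ cong ((x -ᴳ y) +ᴳ_) (sym (⁻¹-∙-comm z (-ᴳ w))) ⟩
    (x -ᴳ y) +ᴳ (-ᴳ z +ᴳ -ᴳ (-ᴳ w))    ≡⟨ interchange x (-ᴳ y) (-ᴳ z) (-ᴳ (-ᴳ w)) ⟩
    (x -ᴳ z) +ᴳ (-ᴳ y +ᴳ -ᴳ (-ᴳ w))    ≡⟨ cong ((x -ᴳ z) +ᴳ_) (⁻¹-∙-comm y (-ᴳ w)) ⟩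
    (x -ᴳ z) -ᴳ (y -ᴳ w)               ∎
    where open ≡-Reasoning

  ∑-translate : ∀ t (f : Fin n → ℕ) → ∑[ x ← allFin n ] f (x +ᴳ t) ≡ ∑[ x ← allFin n ] f x
  ∑-translate t f = begin
    ∑[ x ← allFin n ] f (x +ᴳ t) ≡⟨ ∑-tabulate {k = n} id (λ x → f (x +ᴳ t)) ⟩
    ℕSum.sum (λ x → f (x +ᴳ t))  ≡⟨ sym (ℕSum.sum-permute f (permutation (_+ᴳ t) (_-ᴳ t) (//-rightDividesˡ t) (//-rightDividesʳ t))) ⟩
    ℕSum.sum f                   ≡⟨ sym (∑-tabulate {k = n} id f) ⟩
    ∑[ x ← allFin n ] f x        ∎
    where open ≡-Reasoning

  ∑-allMaps-translate : ∀ k (t : Vec (Fin n) k) (f : Vec (Fin n) k → ℕ) →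
                        ∑[ v ← allMaps k n ] f (zipWith _+ᴳ_ v t) ≡ ∑[ v ← allMaps k n ] f v
  ∑-allMaps-translate zero [] f = refl
  ∑-allMaps-translate (suc k) (t₀ ∷ t) f = begin
    ∑[ v ← allMaps (suc k) n ] f (zipWith _+ᴳ_ v (t₀ ∷ t))
      ≡⟨ ∑-allMaps-suc k _ ⟩
    ∑[ v ← allMaps k n ] ∑[ x ← allFin n ] f ((x +ᴳ t₀) ∷ zipWith _+ᴳ_ v t)
      ≡⟨ ∑-cong (allMaps k n) (λ v → ∑-translate t₀ (λ x → f (x ∷ zipWith _+ᴳ_ v t))) ⟩
    ∑[ v ← allMaps k n ] ∑[ x ← allFin n ] f (x ∷ zipWith _+ᴳ_ v t)
      ≡⟨ ∑-allMaps-translate k t (λ w → ∑[ x ← allFin n ] f (x ∷ w)) ⟩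
    ∑[ w ← allMaps k n ] ∑[ x ← allFin n ] f (x ∷ w)
      ≡⟨ sym (∑-allMaps-suc k f) ⟩
    ∑[ v ← allMaps (suc k) n ] f v ∎
    where open ≡-Reasoning

  walks-translate : ∀ c a b t → walks c (a +ᴳ t) (b +ᴳ t) ≡ walks c a b
  walks-translate zero a b t = cong (λ z → ⟦ lookup S z ⟧) (-ᴳ-translate a b t)
  walks-translate (suc c) a b t = begin
    ∑[ m ← allFin n ] A (a +ᴳ t) m * walks c m (b +ᴳ t)
      ≡⟨ sym (∑-translate t _) ⟩
    ∑[ m ← allFin n ] A (a +ᴳ t) (m +ᴳ t) * walks c (m +ᴳ t) (b +ᴳ t)
      ≡⟨ ∑-cong (allFin n) (λ m → cong₂ _*_ (walks-translate zero a m t) (walks-translate c m b t)) ⟩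
    ∑[ m ← allFin n ] A a m * walks c m b ∎
    where open ≡-Reasoning

  walks-from-0 : ∀ c a b → walks c a b ≡ walks c 0# (b -ᴳ a)
  walks-from-0 c a b = sym (trans (cong (λ z → walks c z (b -ᴳ a)) (sym (inverseʳ a))) (walks-translate c a b (-ᴳ a)))

  degree : ℕ
  degree = ∑[ z ← allFin n ] ⟦ lookup S z ⟧

  degree≤n : degree ≤ n
  degree≤n = begin
    degree                  ≤⟨ ∑-mono-≤ (allFin n) (λ z → ⟦⟧≤1 (lookup S z)) ⟩
    ∑[ z ← allFin n ] 1     ≡⟨ ∑-allFin-const 1 ⟩
    n * 1                   ≡⟨ *-identityʳ n ⟩
    n                       ∎
    where open ≤-Reasoning

  ∑-A : ∀ a → ∑[ b ← allFin n ] A a b ≡ degree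
  ∑-A a = trans (sym (∑-translate a (A a)))
                (∑-cong (allFin n) (λ z → cong (λ w → ⟦ lookup S w ⟧) (//-rightDividesʳ a z)))

  ∑-walks : ∀ c a → ∑[ b ← allFin n ] walks c a b ≡ degree ^ suc c
  ∑-walks zero a = trans (∑-A a) (sym (*-identityʳ degree))
  ∑-walks (suc c) a = begin
    ∑[ b ← allFin n ] ∑[ m ← allFin n ] A a m * walks c m b   ≡⟨ ∑-comm (allFin n) (allFin n) _ ⟩
    ∑[ m ← allFin n ] ∑[ b ← allFin n ] A a m * walks c m b   ≡⟨ ∑-cong (allFin n) (λ m → sym (*-distribˡ-∑ (A a m) (allFin n) _)) ⟩
    ∑[ m ← allFin n ] A a m * (∑[ b ← allFin n ] walks c m b) ≡⟨ ∑-cong (allFin n) (λ m → cong (A a m *_) (∑-walks c m)) ⟩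
    ∑[ m ← allFin n ] A a m * degree ^ suc c                  ≡⟨ sym (*-distribʳ-∑ _ (allFin n) (A a)) ⟩
    (∑[ m ← allFin n ] A a m) * degree ^ suc c                ≡⟨ cong (_* degree ^ suc c) (∑-A a) ⟩
    degree ^ suc (suc c)                                      ∎
    where open ≡-Reasoning

  homCount-K₂-Cayley : homCount 2 K₂Adj n adj ≡ n * degree
  homCount-K₂-Cayley = trans homCount-K₂ (trans (∑-cong (allFin n) ∑-A) (∑-allFin-const degree))

  walks-cross : ∀ c pa pb qa qb → walks c (pb -ᴳ pa) (qb -ᴳ qa) ≡ walks c (qa -ᴳ pa) (qb -ᴳ pb)
  walks-cross c pa pb qa qb = begin
    walks c (pb -ᴳ pa) (qb -ᴳ qa)            ≡⟨ walks-from-0 c _ _ ⟩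
    walks c 0# ((qb -ᴳ qa) -ᴳ (pb -ᴳ pa))    ≡⟨ cong (walks c 0#) (-ᴳ-interchange qb qa pb pa) ⟩
    walks c 0# ((qb -ᴳ pb) -ᴳ (qa -ᴳ pa))    ≡⟨ sym (walks-from-0 c _ _) ⟩
    walks c (qa -ᴳ pa) (qb -ᴳ pb)            ∎
    where open ≡-Reasoning

  module _ {V₀ : ℕ} (es : List (Fin V₀ × Fin V₀)) (ks : Fin (length es) → ℕ) where
    private
      l = length es

      δ : Vec (Fin n) V₀ → Fin V₀ → Fin V₀ → Fin n
      δ φ a b = lookup φ b -ᴳ lookup φ a

    homWeightAt : Vec (Fin n) V₀ → ℕ
    homWeightAt φ = ∏ᴱ es ks (λ a b k → walks (internal k) (lookup φ a) (lookup φ b))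

    homSum : ℕ
    homSum = ∑[ φ ← allMaps V₀ n ] homWeightAt φ

    degreeProduct : ℕ
    degreeProduct = ∏ᴱ es ks (λ _ _ k → degree ^ suc k)

    -- Cutting every subdivided edge ab at its midpoint and translating that midpoint by − φ(a),
    -- halfCount u counts the φ with, for each edge ab, a walk of length k + 1 from φ(b) − φ(a) to u_ab.
    halfWeight : Vec (Fin n) l → Vec (Fin n) V₀ → ℕ
    halfWeight u φ = ∏ᴱ es (λ i → ks i , lookup u i) (λ a b (k , m) → walks k (δ φ a b) m)

    halfCount : Vec (Fin n) l → ℕ
    halfCount u = ∑[ φ ← allMaps V₀ n ] halfWeight u φ

    ∑-halfCount : ∑[ u ← allMaps l n ] halfCount u ≡ n ^ V₀ * degreeProduct
    ∑-halfCount = begin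
      ∑[ u ← allMaps l n ] ∑[ φ ← allMaps V₀ n ] halfWeight u φ
        ≡⟨ ∑-comm (allMaps l n) (allMaps V₀ n) _ ⟩
      ∑[ φ ← allMaps V₀ n ] ∑[ u ← allMaps l n ] halfWeight u φ
        ≡⟨ ∑-cong (allMaps V₀ n) (λ φ → ∑-∏ᴱ es ks _) ⟩
      ∑[ φ ← allMaps V₀ n ] ∏ᴱ es ks (λ a b k → ∑[ m ← allFin n ] walks k (δ φ a b) m)
        ≡⟨ ∑-cong (allMaps V₀ n) (λ φ → ∏ᴱ-cong es ks (λ a b k → ∑-walks k (δ φ a b))) ⟩
      ∑[ φ ← allMaps V₀ n ] degreeProduct
        ≡⟨ ∑-allMaps-const V₀ degreeProduct ⟩
      n ^ V₀ * degreeProduct ∎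
      where open ≡-Reasoning

    -- The two halves of the edge ab, seen from φ and from φ′, glue at their common midpoint into a walk
    -- of length 2k + 2 from φ′(a) − φ(a) to φ′(b) − φ(b).
    halfWeight-glue : ∀ φ φ′ → ∑[ u ← allMaps l n ] halfWeight u φ * halfWeight u φ′
                               ≡ homWeightAt (zipWith _+ᴳ_ φ′ (Vec.map -ᴳ_ φ))
    halfWeight-glue φ φ′ = begin
      ∑[ u ← allMaps l n ] halfWeight u φ * halfWeight u φ′
        ≡⟨ ∑-cong (allMaps l n) (λ u → ∏ᴱ-* es _ _ _) ⟩
      ∑[ u ← allMaps l n ] ∏ᴱ es (λ i → ks i , lookup u i) (λ a b (k , m) → walks k (δ φ a b) m * walks k (δ φ′ a b) m)
        ≡⟨ ∑-∏ᴱ es ks _ ⟩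
      ∏ᴱ es ks (λ a b k → ∑[ m ← allFin n ] walks k (δ φ a b) m * walks k (δ φ′ a b) m)
        ≡⟨ ∏ᴱ-cong es ks glue ⟩
      homWeightAt (zipWith _+ᴳ_ φ′ (Vec.map -ᴳ_ φ)) ∎
      where
      open ≡-Reasoning
      lookup-difference : ∀ i → lookup (zipWith _+ᴳ_ φ′ (Vec.map -ᴳ_ φ)) i ≡ lookup φ′ i -ᴳ lookup φ i
      lookup-difference i = trans (Vec.lookup-zipWith _+ᴳ_ i φ′ _) (cong (lookup φ′ i +ᴳ_) (Vec.lookup-map i -ᴳ_ φ))
      glue : ∀ a b k → ∑[ m ← allFin n ] walks k (δ φ a b) m * walks k (δ φ′ a b) m
        ≡ walks (internal k) (lookup (zipWith _+ᴳ_ φ′ (Vec.map -ᴳ_ φ)) a) (lookup (zipWith _+ᴳ_ φ′ (Vec.map -ᴳ_ φ)) b)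
      glue a b k = begin
        ∑[ m ← allFin n ] walks k (δ φ a b) m * walks k (δ φ′ a b) m
          ≡⟨ ∑-cong (allFin n) (λ m → cong (walks k (δ φ a b) m *_) (walks-sym k _ m)) ⟩
        ∑[ m ← allFin n ] walks k (δ φ a b) m * walks k m (δ φ′ a b)
          ≡⟨ sym (walks-split k k _ _) ⟩
        walks (k + suc k) (δ φ a b) (δ φ′ a b)
          ≡⟨ cong (λ c → walks c (δ φ a b) (δ φ′ a b)) (sym (internal≡ k)) ⟩
        walks (internal k) (δ φ a b) (δ φ′ a b)
          ≡⟨ walks-cross (internal k) (lookup φ a) (lookup φ b) (lookup φ′ a) (lookup φ′ b) ⟩
        walks (internal k) (lookup φ′ a -ᴳ lookup φ a) (lookup φ′ b -ᴳ lookup φ b)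
          ≡⟨ sym (cong₂ (walks (internal k)) (lookup-difference a) (lookup-difference b)) ⟩
        walks (internal k) (lookup (zipWith _+ᴳ_ φ′ (Vec.map -ᴳ_ φ)) a) (lookup (zipWith _+ᴳ_ φ′ (Vec.map -ᴳ_ φ)) b) ∎

    ∑-halfCount² : ∑[ u ← allMaps l n ] halfCount u * halfCount u ≡ n ^ V₀ * homSum
    ∑-halfCount² = begin
      ∑[ u ← allMaps l n ] halfCount u * halfCount u
        ≡⟨ ∑-cong (allMaps l n) (λ u → ∑-*-∑ (allMaps V₀ n) (allMaps V₀ n) _ _) ⟩
      ∑[ u ← allMaps l n ] ∑[ φ ← allMaps V₀ n ] ∑[ φ′ ← allMaps V₀ n ] halfWeight u φ * halfWeight u φ′
        ≡⟨ ∑-comm (allMaps l n) (allMaps V₀ n) _ ⟩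
      ∑[ φ ← allMaps V₀ n ] ∑[ u ← allMaps l n ] ∑[ φ′ ← allMaps V₀ n ] halfWeight u φ * halfWeight u φ′
        ≡⟨ ∑-cong (allMaps V₀ n) (λ φ → ∑-comm (allMaps l n) (allMaps V₀ n) _) ⟩
      ∑[ φ ← allMaps V₀ n ] ∑[ φ′ ← allMaps V₀ n ] ∑[ u ← allMaps l n ] halfWeight u φ * halfWeight u φ′
        ≡⟨ ∑-cong (allMaps V₀ n) (λ φ → ∑-cong (allMaps V₀ n) (halfWeight-glue φ)) ⟩
      ∑[ φ ← allMaps V₀ n ] ∑[ φ′ ← allMaps V₀ n ] homWeightAt (zipWith _+ᴳ_ φ′ (Vec.map -ᴳ_ φ))
        ≡⟨ ∑-cong (allMaps V₀ n) (λ φ → ∑-allMaps-translate V₀ (Vec.map -ᴳ_ φ) homWeightAt) ⟩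
      ∑[ φ ← allMaps V₀ n ] homSum
        ≡⟨ ∑-allMaps-const V₀ homSum ⟩
      n ^ V₀ * homSum ∎
      where open ≡-Reasoning

    homSum-bound : n ^ V₀ * (degreeProduct * degreeProduct) ≤ n ^ l * homSum
    homSum-bound = *-cancelˡ-≤ (n ^ V₀) {{m^n≢0 n V₀}} (begin
      N₀ * (N₀ * (D * D))                                            ≡⟨ regroup N₀ D ⟩
      (N₀ * D) * (N₀ * D)                                            ≡⟨ sym (cong₂ _*_ ∑-halfCount ∑-halfCount) ⟩
      (∑[ u ← allMaps l n ] halfCount u) * (∑[ u ← allMaps l n ] halfCount u)
        ≤⟨ cauchy-schwarz (allMaps l n) halfCount ⟩
      length (allMaps l n) * (∑[ u ← allMaps l n ] halfCount u * halfCount u)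
        ≡⟨ cong₂ _*_ (length-allMaps l) ∑-halfCount² ⟩
      n ^ l * (N₀ * homSum)                                          ≡⟨ x∙yz≈y∙xz (n ^ l) N₀ homSum ⟩
      N₀ * (n ^ l * homSum)                                          ∎)
      where
      open ≤-Reasoning
      open import Algebra.Properties.CommutativeSemigroup *-commutativeSemigroup using (x∙yz≈y∙xz)
      N₀ = n ^ V₀
      D = degreeProduct
      regroup : ∀ a b → a * (a * (b * b)) ≡ (a * b) * (a * b)
      regroup = solve-∀

  degreeProduct² : ∀ {V₀} (es : List (Fin V₀ × Fin V₀)) ks →
                   degreeProduct es ks * degreeProduct es ks ≡ degree ^ (newVertices es ks + length es)
  degreeProduct² [] ks = refl
  degreeProduct² ((a , b) ∷ es) ks = begin
    (degree ^ suc k * D) * (degree ^ suc k * D)                ≡⟨ square-* (degree ^ suc k) D ⟩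
    (degree ^ suc k * degree ^ suc k) * (D * D)                ≡⟨ cong₂ _*_ (sym (^-distribˡ-+-* degree (suc k) (suc k))) (degreeProduct² es ks′) ⟩
    degree ^ (suc k + suc k) * degree ^ (m + length es)        ≡⟨ sym (^-distribˡ-+-* degree (suc k + suc k) _) ⟩
    degree ^ (suc k + suc k + (m + length es))                 ≡⟨ cong (degree ^_) (exponent k m (length es)) ⟩
    degree ^ (internal k + m + suc (length es))                ∎
    where
    open ≡-Reasoning
    ks′ = ks ∘ Fin.suc
    k = ks Fin.zero
    m = newVertices es ks′
    D = degreeProduct es ks′
    square-* : ∀ x y → (x * y) * (x * y) ≡ (x * x) * (y * y)
    square-* = solve-∀
    exponent : ∀ k m l → suc k + suc k + (m + l) ≡ suc (2 * k) + m + suc l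
    exponent = solve-∀

  homCount-subdivision-bound : ∀ H₀ ks →
    degree ^ (newVertices (edgeList H₀) ks + length (edgeList H₀)) * n ^ subdivV H₀ ks
      ≤ homCount (subdivV H₀ ks) (subdivAdj H₀ ks) n adj * n ^ (newVertices (edgeList H₀) ks + length (edgeList H₀))
  homCount-subdivision-bound H₀ ks = begin
    degree ^ e * n ^ (V H₀ + nv)                 ≡⟨ cong (degree ^ e *_) (^-distribˡ-+-* n (V H₀) nv) ⟩
    degree ^ e * (n ^ V H₀ * n ^ nv)             ≡⟨ regroup (degree ^ e) (n ^ V H₀) (n ^ nv) ⟩
    n ^ nv * (n ^ V H₀ * degree ^ e)             ≤⟨ *-monoʳ-≤ (n ^ nv) bound ⟩
    n ^ nv * (n ^ length es * homSum es ks)      ≡⟨ regroup′ (n ^ nv) (n ^ length es) (homSum es ks) ⟩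
    homSum es ks * (n ^ nv * n ^ length es)      ≡⟨ cong₂ _*_ (sym (homCount-subdivision H₀ ks)) (sym (^-distribˡ-+-* n nv (length es))) ⟩
    homCount (subdivV H₀ ks) (subdivAdj H₀ ks) n adj * n ^ e ∎
    where
    open ≤-Reasoning
    es = edgeList H₀
    nv = newVertices es ks
    e = nv + length es
    bound : n ^ V H₀ * degree ^ e ≤ n ^ length es * homSum es ks
    bound = subst (λ x → n ^ V H₀ * x ≤ n ^ length es * homSum es ks) (degreeProduct² es ks) (homSum-bound es ks)
    regroup : ∀ a b c → a * (b * c) ≡ c * (b * a)
    regroup = solve-∀
    regroup′ : ∀ a b c → a * (b * c) ≡ c * (a * b)
    regroup′ = solve-∀

  K₂-density : homDensity 2 K₂Adj n adj ≡ + degree / n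
  K₂-density = trans (cong (λ h → + h / n ^ 2) homCount-K₂-Cayley) (/-cong-cross (n * degree) degree (n ^ 2) n (cross n degree))
    where
    instance _ = m^n≢0 n 2
    cross : ∀ n d → n * d * n ≡ d * (n * (n * 1))
    cross = solve-∀

open import Defs
open import Data.Nat using (ℕ; NonZero)
open import Data.List using (length)
open import Data.Fin using (Fin)
open import Data.Fin.Subset using (Subset; _∈_; _∉_)
open import Data.Rational using (_≤_)
open import Algebra.Structures using (IsAbelianGroup)
open import Relation.Binary.PropositionalEquality using (_≡_)

theorem2 : (n : ℕ) .{{_ : NonZero n}}
           (_+_ : Fin n → Fin n → Fin n) (0# : Fin n) (-_ : Fin n → Fin n)
           → IsAbelianGroup _≡_ _+_ 0# -_
           → (S : Subset n) → 0# ∉ S → (∀ x → x ∈ S → (- x) ∈ S)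
           → (H₀ : Graph) (ks : Fin (length (edgeList H₀)) → ℕ)
           → (homDensity 2 K₂Adj n (cayleyAdj _+_ -_ S))
               ^ℚ edgeCount (subdivV H₀ ks) (subdivAdj H₀ ks)
             ≤ homDensity (subdivV H₀ ks) (subdivAdj H₀ ks) n (cayleyAdj _+_ -_ S)
theorem2 n _+_ 0# -_ isAbelianGroup S _ S-sym H₀ ks = begin
  homDensity 2 K₂Adj n adj ^ℚ E           ≡⟨ cong (_^ℚ E) K₂-density ⟩
  (+ degree / n) ^ℚ E                     ≤⟨ /-^ℚ-≤-/ degree n hom (n ^ N) E count-bound ⟩
  homDensity N (subdivAdj H₀ ks) n adj    ∎
  where
  open Cayley _+_ 0# -_ isAbelianGroup S S-sym
  open Ratio using (/-^ℚ-≤-/; ^-ratio-antimono)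
  open Subdivision using (edgeCount-subdivision)
  open import Data.Integer using (+_)
  open import Data.Rational using (_/_)
  import Data.Nat as ℕ
  import Data.Rational.Properties as ℚ
  open ℚ.≤-Reasoning
  N = subdivV H₀ ks
  E = edgeCount N (subdivAdj H₀ ks)
  hom = homCount N (subdivAdj H₀ ks) n adj
  instance _ = m^n≢0 n N
  count-bound : degree ^ E * n ^ N ℕ.≤ hom * n ^ E
  count-bound = ^-ratio-antimono {h = hom} {M = n ^ N} degree≤n
                  (homCount-subdivision-bound H₀ ks) (edgeCount-subdivision H₀ ks)
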